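{- For any $n>0$ and $S\subseteq[2n-1]$ with $|S|=k$, the value $\beta_n(S)$ of the flag $h$-vector of $J(\mathbf{2}\times\mathbf{n})$ equals the number of semistandard Young tableaux $T$ of shape $\langle 2^k\rangle$ with all entries less than $n$ whose set of row sums $\{\gamma_1(T),\dots,\gamma_k(T)\}$ equals $S$.
   Context: $\langle 2^k\rangle$ is the partition $(2,2,\dots,2)$ with $k$ parts. A semistandard Young tableau of shape $\lambda$ is an array $T=(T_{ij})$ of positive integers, $1\le i\le\ell(\lambda)$, $1\le j\le\lambda_i$, weakly increasing along rows and strictly increasing down columns. The row sums are $\gamma_i(T)=\sum_j T_{ij}$ and the paper writes $\mathrm{row}(T)=(\gamma_1(T),\gamma_2(T),\dots)$. $\mathbf{2}\times\mathbf{n}$ is the product of chains $\{1<2\}\times\{1<\dots<n\}$; $J(\mathbf{2}\times\mathbf{n})$ is its lattice of order ideals, graded of rank $2n$ by cardinality. For a finite graded poset $P$ with $\hat0,\hat1$, rank function $\rho$, $\rho(\hat1)=N$, the flag $f$-vector is $\alpha_P(S)=|\{c\text{ a chain of }P:\rho(c)=S\}|$ for $S\subseteq[N-1]$, and the flag $h$-vector is $\beta_P(S)=\sum_{T\subseteq S}(-1)^{|S-T|}\alpha_P(T)$; $\beta_n=\beta_{J(\mathbf{2}\times\mathbf{n})}$. -}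

module Defs where

open import Data.Bool using (Bool; true; false; _∧_; _∨_; not; if_then_else_)
open import Data.Nat using (ℕ; zero; suc; _+_; _*_; _∸_; _≤ᵇ_; _<ᵇ_; _≡ᵇ_)
open import Data.Fin using (Fin; toℕ)
open import Data.Vec using (Vec; []; _∷_; lookup; toList)
open import Data.List using (List; []; _∷_; map; filterᵇ; length; allFin; concatMap; foldr)
open import Data.Bool.ListAction using (all; any)
open import Data.Product using (_×_; _,_; proj₁; proj₂)
open import Data.Integer using (ℤ; +_; -1ℤ; _^_) renaming (_+_ to _+ℤ_; _*_ to _*ℤ_)
open import Data.Fin.Subset using (Subset)

allVec : (m : ℕ) → List (Vec Bool m)
allVec zero    = [] ∷ []
allVec (suc m) = concatMap (λ v → (false ∷ v) ∷ (true ∷ v) ∷ []) (allVec m)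

allLists : {A : Set} → ℕ → List A → List (List A)
allLists zero    xs = [] ∷ []
allLists (suc l) xs = concatMap (λ ys → map (λ x → x ∷ ys) xs) (allLists l xs)

allVecsOf : {A : Set} → (l : ℕ) → List A → List (Vec A l)
allVecsOf zero    xs = [] ∷ []
allVecsOf (suc l) xs = concatMap (λ ys → map (λ x → x ∷ ys) xs) (allVecsOf l xs)

count : {A : Set} → (A → Bool) → List A → ℕ
count p xs = length (filterᵇ p xs)

eqListℕ : List ℕ → List ℕ → Bool
eqListℕ []       []       = true
eqListℕ (x ∷ xs) (y ∷ ys) = (x ≡ᵇ y) ∧ eqListℕ xs ys
eqListℕ _        _        = false

consecutive : {A : Set} → (A → A → Bool) → List A → Bool
consecutive r []           = true
consecutive r (x ∷ [])     = true
consecutive r (x ∷ y ∷ xs) = r x y ∧ consecutive r (y ∷ xs)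

-- Subsets of [m] = {1,…,m}: a Subset m, where index i : Fin m stands
-- for the integer toℕ i + 1.

elems : {m : ℕ} → Subset m → List ℕ
elems {m} S = map (λ i → suc (toℕ i)) (filterᵇ (λ i → lookup S i) (allFin m))

_∈ℕᵇ_ : {m : ℕ} → ℕ → Subset m → Bool
x ∈ℕᵇ S = any (λ y → x ≡ᵇ y) (elems S)

_⊆ᵇ_ : {m : ℕ} → Subset m → Subset m → Bool
_⊆ᵇ_ {m} T S = all (λ i → not (lookup T i) ∨ lookup S i) (allFin m)

diffCard : {m : ℕ} → Subset m → Subset m → ℕ
diffCard {m} S T = count (λ i → lookup S i ∧ not (lookup T i)) (allFin m)

-- A chain c with ρ(c) = T (T ⊆ [N-1]) is listed in increasing
-- order; its ranks are then exactly the increasing list of elements of T.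

record FiniteGradedPoset : Set₁ where
  field
    Carrier  : Set
    elements : List Carrier          -- all elements, each exactly once
    _≤ᵇ'_    : Carrier → Carrier → Bool
    rank     : Carrier → ℕ
    N        : ℕ                      -- ρ(1̂)

open FiniteGradedPoset

flagF : (P : FiniteGradedPoset) → Subset (N P ∸ 1) → ℕ
flagF P T =
  count (λ c → eqListℕ (map (rank P) c) (elems T) ∧ consecutive (_≤ᵇ'_ P) c)
        (allLists (length (elems T)) (elements P))

flagH : (P : FiniteGradedPoset) → Subset (N P ∸ 1) → ℤ
flagH P S =
  foldr _+ℤ_ (+ 0)
    (map (λ T → (-1ℤ ^ diffCard S T) *ℤ (+ flagF P T))
         (filterᵇ (λ T → T ⊆ᵇ S) (allVec (N P ∸ 1))))

-- The poset 2 × n and its lattice of order ideals J(2 × n).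
-- A subset of 2 × n is a Vec (Vec Bool n) 2: entry (i , j) is whether
-- the element (i+1 , j+1) belongs to it.

SubsetP : ℕ → Set
SubsetP n = Vec (Vec Bool n) 2

memP : {n : ℕ} → SubsetP n → Fin 2 → Fin n → Bool
memP I i j = lookup (lookup I i) j

_≤Finᵇ_ : {m : ℕ} → Fin m → Fin m → Bool
i ≤Finᵇ j = toℕ i ≤ᵇ toℕ j

isIdealᵇ : {n : ℕ} → SubsetP n → Bool
isIdealᵇ {n} I =
  all (λ i → all (λ j → all (λ i' → all (λ j' →
      not ((i' ≤Finᵇ i) ∧ (j' ≤Finᵇ j) ∧ memP I i j) ∨ memP I i' j')
    (allFin n)) (allFin 2)) (allFin n)) (allFin 2)

inclᵇ : {n : ℕ} → SubsetP n → SubsetP n → Bool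
inclᵇ {n} I I' =
  all (λ i → all (λ j → not (memP I i j) ∨ memP I' i j) (allFin n)) (allFin 2)

cardP : {n : ℕ} → SubsetP n → ℕ
cardP {n} I = count (λ ij → memP I (proj₁ ij) (proj₂ ij))
                    (concatMap (λ i → map (λ j → (i , j)) (allFin n)) (allFin 2))

allSubsetsP : (n : ℕ) → List (SubsetP n)
allSubsetsP n = allVecsOf 2 (allVec n)

J2×n : ℕ → FiniteGradedPoset
J2×n n = record
  { Carrier  = SubsetP n
  ; elements = filterᵇ isIdealᵇ (allSubsetsP n)
  ; _≤ᵇ'_    = inclᵇ
  ; rank     = cardP
  ; N        = 2 * n
  }

β : (n : ℕ) → Subset (2 * n ∸ 1) → ℤ
β n S = flagH (J2×n n) S

-- Semistandard Young tableaux of shape ⟨2^k⟩ with entries in {1,…,n-1}.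
-- A filling of shape ⟨2^k⟩ is a Vec (ℕ × ℕ) k of rows (T_i1 , T_i2).

Filling : ℕ → Set
Filling k = Vec (ℕ × ℕ) k

rowsList : {k : ℕ} → Filling k → List (ℕ × ℕ)
rowsList T = toList T

isSSYTᵇ : {k : ℕ} → Filling k → Bool
isSSYTᵇ T =
  all (λ r → (1 ≤ᵇ proj₁ r) ∧ (proj₁ r ≤ᵇ proj₂ r)) (rowsList T)
  ∧ consecutive (λ r r' → (proj₁ r <ᵇ proj₁ r') ∧ (proj₂ r <ᵇ proj₂ r')) (rowsList T)

entriesBelowᵇ : {k : ℕ} → ℕ → Filling k → Bool
entriesBelowᵇ n T = all (λ r → (proj₁ r <ᵇ n) ∧ (proj₂ r <ᵇ n)) (rowsList T)

rowSums : {k : ℕ} → Filling k → List ℕ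
rowSums T = map (λ r → proj₁ r + proj₂ r) (rowsList T)

rowSumSetEqᵇ : {k m : ℕ} → Filling k → Subset m → Bool
rowSumSetEqᵇ T S =
  all (λ x → x ∈ℕᵇ S) (rowSums T) ∧ all (λ x → any (λ y → x ≡ᵇ y) (rowSums T)) (elems S)

-- entries range over {0,…,n-1}; the predicates cut out the SSYT with entries < n
range : ℕ → List ℕ
range n = map toℕ (allFin n)

numTableaux : (n k : ℕ) → Subset (2 * n ∸ 1) → ℕ
numTableaux n k S =
  count (λ T → isSSYTᵇ T ∧ entriesBelowᵇ n T ∧ rowSumSetEqᵇ T S)
        (allVecsOf k (concatMap (λ a → map (λ b → (a , b)) (range n)) (range n)))

-- By Möbius inversion over the subsets of [2n-1], it suffices that the flag f-vector α(T)
-- counts the pairs (U, P) with U ⊆ T and P a tableau whose set of row sums is U.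
-- An ideal of 2 × n is a pair of row lengths n ≥ a ≥ b ≥ 0, of rank a + b. Along a chain
-- of ideals with ranks T, an ideal (a, b) is read as the tableau row (b, a) when b exceeds
-- the first entry of the previous row and the first row grows at the next step (a < n for
-- the last ideal); every other ideal of the chain is determined by its successor.

module Submission where

open import Data.Bool using (Bool; true; false; _∧_; _∨_; not; if_then_else_)
import Data.Bool as Bool
open import Data.Bool.Properties using (∧-identityʳ; ∧-zeroʳ; ∧-idem; ∧-conicalˡ; ∧-conicalʳ)
open import Data.Bool.ListAction using (all; any)
open import Data.Bool.Solver using (module ∨-∧-Solver)
open ∨-∧-Solver using (solve; _:*_; _:=_)
open import Data.Nat using (ℕ; zero; suc; _+_; _*_; _∸_; _≤ᵇ_; _<ᵇ_; _≡ᵇ_; _≤_; _<_; z≤n; s≤s; z<s)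
open import Data.Nat.Properties
import Data.Nat.Tactic.RingSolver as ℕ-Ring
open import Data.Integer using (ℤ; -1ℤ; _^_) renaming (+_ to pos; _+_ to _+ℤ_; _*_ to _*ℤ_)
import Data.Integer.Properties as ℤ
import Data.Integer.Tactic.RingSolver as ℤ-Ring
open import Data.Fin using (Fin; toℕ)
import Data.Fin as Fin
open import Data.List using (List; []; _∷_; map; filterᵇ; length; concatMap; foldr; _++_; tabulate; allFin)
open import Data.List.Membership.Propositional using (_∈_)
open import Data.List.Relation.Unary.Any using (here; there)
open import Data.List.Relation.Unary.Linked as Linked using (Linked; []; [-]; _∷_)
open import Data.Vec using (Vec; []; _∷_; lookup; toList)
open import Data.Fin.Subset using (Subset; ∣_∣)
open import Data.Product using (_×_; _,_; proj₁; proj₂)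
open import Data.Sum using (inj₁; inj₂)
open import Data.Empty using (⊥; ⊥-elim)
open import Function using (_∘_; id; case_of_)
open import Relation.Binary.PropositionalEquality
open import Relation.Binary.Definitions using (tri<; tri≈; tri>)
open import Relation.Nullary using (¬_; yes; no)
open import Defs

ind : Bool → ℕ
ind true  = 1
ind false = 0

ind-∧ : ∀ p q → ind (p ∧ q) ≡ ind p * ind q
ind-∧ true  q = sym (+-identityʳ (ind q))
ind-∧ false q = refl

sumL : {A : Set} → List A → (A → ℕ) → ℕ
sumL []       f = 0
sumL (x ∷ xs) f = f x + sumL xs f

sumL-++ : {A : Set} (xs ys : List A) (f : A → ℕ) → sumL (xs ++ ys) f ≡ sumL xs f + sumL ys f
sumL-++ []       ys f = refl
sumL-++ (x ∷ xs) ys f = trans (cong (f x +_) (sumL-++ xs ys f)) (sym (+-assoc (f x) _ _))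

sumL-map : {A B : Set} (g : A → B) (xs : List A) (f : B → ℕ) → sumL (map g xs) f ≡ sumL xs (f ∘ g)
sumL-map g []       f = refl
sumL-map g (x ∷ xs) f = cong (f (g x) +_) (sumL-map g xs f)

sumL-concatMap : {A B : Set} (g : A → List B) (xs : List A) (f : B → ℕ) →
  sumL (concatMap g xs) f ≡ sumL xs (λ x → sumL (g x) f)
sumL-concatMap g []       f = refl
sumL-concatMap g (x ∷ xs) f =
  trans (sumL-++ (g x) (concatMap g xs) f) (cong (sumL (g x) f +_) (sumL-concatMap g xs f))

sumL-cong : {A : Set} (xs : List A) {f g : A → ℕ} → (∀ x → f x ≡ g x) → sumL xs f ≡ sumL xs g
sumL-cong []       e = refl
sumL-cong (x ∷ xs) e = cong₂ _+_ (e x) (sumL-cong xs e)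

sumL-+ : {A : Set} (xs : List A) (f g : A → ℕ) → sumL xs (λ x → f x + g x) ≡ sumL xs f + sumL xs g
sumL-+ []       f g = refl
sumL-+ (x ∷ xs) f g =
  trans (cong (f x + g x +_) (sumL-+ xs f g)) (+-+-exchange (f x) (g x) (sumL xs f) (sumL xs g))
  where
  +-+-exchange : ∀ a b c d → a + b + (c + d) ≡ a + c + (b + d)
  +-+-exchange = ℕ-Ring.solve-∀

sumL-*ˡ : {A : Set} (c : ℕ) (xs : List A) (f : A → ℕ) → c * sumL xs f ≡ sumL xs (λ x → c * f x)
sumL-*ˡ c []       f = *-zeroʳ c
sumL-*ˡ c (x ∷ xs) f = trans (*-distribˡ-+ c (f x) (sumL xs f)) (cong (c * f x +_) (sumL-*ˡ c xs f))

sumL-zero : {A : Set} (xs : List A) → sumL xs (λ _ → 0) ≡ 0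
sumL-zero []       = refl
sumL-zero (x ∷ xs) = sumL-zero xs

sumL-swap : {A B : Set} (xs : List A) (ys : List B) (f : A → B → ℕ) →
  sumL xs (λ x → sumL ys (f x)) ≡ sumL ys (λ y → sumL xs (λ x → f x y))
sumL-swap []       ys f = sym (sumL-zero ys)
sumL-swap (x ∷ xs) ys f =
  trans (cong (sumL ys (f x) +_) (sumL-swap xs ys f))
        (sym (sumL-+ ys (f x) (λ y → sumL xs (λ x' → f x' y))))

count≡sumL : {A : Set} (p : A → Bool) (xs : List A) → count p xs ≡ sumL xs (ind ∘ p)
count≡sumL p []       = refl
count≡sumL p (x ∷ xs) with p x
... | true  = cong suc (count≡sumL p xs)
... | false = count≡sumL p xs

sumL-filter : {A : Set} (p : A → Bool) (xs : List A) (f : A → ℕ) →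
  sumL (filterᵇ p xs) f ≡ sumL xs (λ x → ind (p x) * f x)
sumL-filter p []       f = refl
sumL-filter p (x ∷ xs) f with p x
... | true  = cong₂ _+_ (sym (+-identityʳ (f x))) (sumL-filter p xs f)
... | false = sumL-filter p xs f

sumL-tabulate : {A : Set} (m : ℕ) (g : Fin m → A) (f : A → ℕ) →
  sumL (tabulate g) f ≡ sumL (allFin m) (f ∘ g)
sumL-tabulate zero    g f = refl
sumL-tabulate (suc m) g f =
  cong (f (g Fin.zero) +_)
       (trans (sumL-tabulate m (g ∘ Fin.suc) f) (sym (sumL-tabulate m Fin.suc (f ∘ g))))

sumL-allVec : (m : ℕ) (f : Vec Bool (suc m) → ℕ) →
  sumL (allVec (suc m)) f ≡ sumL (allVec m) (λ v → f (false ∷ v) + f (true ∷ v))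
sumL-allVec m f =
  trans (sumL-concatMap _ (allVec m) f)
        (sumL-cong (allVec m) (λ v → cong (f (false ∷ v) +_) (+-identityʳ (f (true ∷ v)))))

Σ< : ℕ → (ℕ → ℕ) → ℕ
Σ< zero    f = 0
Σ< (suc m) f = Σ< m f + f m

Σ<-cong : ∀ m {f g : ℕ → ℕ} → (∀ a → a < m → f a ≡ g a) → Σ< m f ≡ Σ< m g
Σ<-cong zero    e = refl
Σ<-cong (suc m) e = cong₂ _+_ (Σ<-cong m (λ a a<m → e a (m<n⇒m<1+n a<m))) (e m ≤-refl)

Σ<-+ : ∀ m (f g : ℕ → ℕ) → Σ< m (λ x → f x + g x) ≡ Σ< m f + Σ< m g
Σ<-+ zero    f g = refl
Σ<-+ (suc m) f g =
  trans (cong (_+ (f m + g m)) (Σ<-+ m f g)) (+-+-exchange (Σ< m f) (Σ< m g) (f m) (g m))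
  where
  +-+-exchange : ∀ a b c d → a + b + (c + d) ≡ a + c + (b + d)
  +-+-exchange = ℕ-Ring.solve-∀

Σ<-*ˡ : ∀ c m (f : ℕ → ℕ) → c * Σ< m f ≡ Σ< m (λ x → c * f x)
Σ<-*ˡ c zero    f = *-zeroʳ c
Σ<-*ˡ c (suc m) f = trans (*-distribˡ-+ c (Σ< m f) (f m)) (cong (_+ c * f m) (Σ<-*ˡ c m f))

Σ<-zero : ∀ m (f : ℕ → ℕ) → (∀ a → a < m → f a ≡ 0) → Σ< m f ≡ 0
Σ<-zero zero    f h = refl
Σ<-zero (suc m) f h = cong₂ _+_ (Σ<-zero m f (λ a a<m → h a (m<n⇒m<1+n a<m))) (h m ≤-refl)

Σ<-swap : ∀ m k (f : ℕ → ℕ → ℕ) → Σ< m (λ a → Σ< k (f a)) ≡ Σ< k (λ b → Σ< m (λ a → f a b))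
Σ<-swap zero    k f = sym (Σ<-zero k _ (λ _ _ → refl))
Σ<-swap (suc m) k f =
  trans (cong (_+ Σ< k (f m)) (Σ<-swap m k f)) (sym (Σ<-+ k (λ b → Σ< m (λ a → f a b)) (f m)))

Σ<-shift : ∀ m (f : ℕ → ℕ) → Σ< (suc m) f ≡ f 0 + Σ< m (f ∘ suc)
Σ<-shift zero    f = +-comm 0 (f 0)
Σ<-shift (suc m) f = trans (cong (_+ f (suc m)) (Σ<-shift m f)) (+-assoc (f 0) _ _)

sumL-range : ∀ m (f : ℕ → ℕ) → sumL (range m) f ≡ Σ< m f
sumL-range zero    f = refl
sumL-range (suc m) f = begin
  f 0 + sumL (map toℕ (tabulate {n = m} Fin.suc)) f ≡⟨ cong (f 0 +_) (sumL-map toℕ (tabulate {n = m} Fin.suc) f) ⟩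
  f 0 + sumL (tabulate {n = m} Fin.suc) (f ∘ toℕ) ≡⟨ cong (f 0 +_) (sumL-tabulate m Fin.suc (f ∘ toℕ)) ⟩
  f 0 + sumL (allFin m) (f ∘ suc ∘ toℕ)        ≡⟨ cong (f 0 +_) (sym (sumL-map toℕ (allFin m) (f ∘ suc))) ⟩
  f 0 + sumL (range m) (f ∘ suc)               ≡⟨ cong (f 0 +_) (sumL-range m (f ∘ suc)) ⟩
  f 0 + Σ< m (f ∘ suc)                         ≡⟨ Σ<-shift m f ⟨
  Σ< (suc m) f                                 ∎
  where open ≡-Reasoning

sumL-Σ< : {A : Set} (xs : List A) (m : ℕ) (f : A → ℕ → ℕ) →
  sumL xs (λ x → Σ< m (f x)) ≡ Σ< m (λ a → sumL xs (λ x → f x a))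
sumL-Σ< xs zero    f = sumL-zero xs
sumL-Σ< xs (suc m) f = trans (sumL-+ xs _ _) (cong (_+ sumL xs (λ x → f x m)) (sumL-Σ< xs m f))

bool-ext : ∀ {a b : Bool} → (a ≡ true → b ≡ true) → (b ≡ true → a ≡ true) → a ≡ b
bool-ext {true}  {true}  f g = refl
bool-ext {true}  {false} f g = sym (f refl)
bool-ext {false} {true}  f g = g refl
bool-ext {false} {false} f g = refl

∧-true : ∀ {a b : Bool} → a ≡ true → b ≡ true → (a ∧ b) ≡ true
∧-true refl refl = refl

∧-split : ∀ a b → (a ∧ b) ≡ true → (a ≡ true) × (b ≡ true)
∧-split true true _ = refl , refl

T⇒≡true : ∀ {b} → Bool.T b → b ≡ true
T⇒≡true {true} _ = refl

≡true⇒T : ∀ {b} → b ≡ true → Bool.T b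
≡true⇒T refl = _

from-<ᵇ : ∀ {m n} → (m <ᵇ n) ≡ true → m < n
from-<ᵇ {m} {n} e = <ᵇ⇒< m n (≡true⇒T e)

to-<ᵇ : ∀ {m n} → m < n → (m <ᵇ n) ≡ true
to-<ᵇ p = T⇒≡true (<⇒<ᵇ p)

from-≤ᵇ : ∀ {m n} → (m ≤ᵇ n) ≡ true → m ≤ n
from-≤ᵇ {m} {n} e = ≤ᵇ⇒≤ m n (≡true⇒T e)

to-≤ᵇ : ∀ {m n} → m ≤ n → (m ≤ᵇ n) ≡ true
to-≤ᵇ p = T⇒≡true (≤⇒≤ᵇ p)

from-≡ᵇ : ∀ {m n} → (m ≡ᵇ n) ≡ true → m ≡ n
from-≡ᵇ {m} {n} e = ≡ᵇ⇒≡ m n (≡true⇒T e)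

≡ᵇ-refl : ∀ m → (m ≡ᵇ m) ≡ true
≡ᵇ-refl m = T⇒≡true (≡⇒≡ᵇ m m refl)

not-true⇒false : ∀ {b : Bool} → (b ≡ true → ⊥) → b ≡ false
not-true⇒false {true}  h = ⊥-elim (h refl)
not-true⇒false {false} h = refl

all-tabulate : {A : Set} (m : ℕ) (g : Fin m → A) (p : A → Bool) →
  all p (tabulate g) ≡ all (p ∘ g) (allFin m)
all-tabulate zero    g p = refl
all-tabulate (suc m) g p =
  cong (p (g Fin.zero) ∧_) (trans (all-tabulate m (g ∘ Fin.suc) p) (sym (all-tabulate m Fin.suc (p ∘ g))))

all-allFin-suc : ∀ m (p : Fin (suc m) → Bool) → all p (allFin (suc m)) ≡ (p Fin.zero ∧ all (p ∘ Fin.suc) (allFin m))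
all-allFin-suc m p = cong (p Fin.zero ∧_) (all-tabulate m Fin.suc p)

all-allFin⇒ : ∀ m (p : Fin m → Bool) → all p (allFin m) ≡ true → ∀ i → p i ≡ true
all-allFin⇒ (suc m) p e Fin.zero    = ∧-conicalˡ _ _ e
all-allFin⇒ (suc m) p e (Fin.suc i) =
  all-allFin⇒ m (p ∘ Fin.suc) (∧-conicalʳ _ _ (trans (sym (all-allFin-suc m p)) e)) i

all-allFin⇐ : ∀ m (p : Fin m → Bool) → (∀ i → p i ≡ true) → all p (allFin m) ≡ true
all-allFin⇐ zero    p h = refl
all-allFin⇐ (suc m) p h =
  trans (all-allFin-suc m p) (∧-true (h Fin.zero) (all-allFin⇐ m (p ∘ Fin.suc) (h ∘ Fin.suc)))

-- Möbius inversion on the Boolean lattice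

sumZ : {A : Set} → List A → (A → ℤ) → ℤ
sumZ xs f = foldr _+ℤ_ (pos 0) (map f xs)

sumZ-cong : {A : Set} (xs : List A) {f g : A → ℤ} → (∀ x → f x ≡ g x) → sumZ xs f ≡ sumZ xs g
sumZ-cong []       e = refl
sumZ-cong (x ∷ xs) e = cong₂ _+ℤ_ (e x) (sumZ-cong xs e)

sumZ-filter : {A : Set} (p : A → Bool) (xs : List A) (f : A → ℤ) →
  sumZ (filterᵇ p xs) f ≡ sumZ xs (λ x → if p x then f x else pos 0)
sumZ-filter p []       f = refl
sumZ-filter p (x ∷ xs) f with p x
... | true  = cong (f x +ℤ_) (sumZ-filter p xs f)
... | false = trans (sumZ-filter p xs f) (sym (ℤ.+-identityˡ _))

sumZ-allVec : (m : ℕ) (f : Vec Bool (suc m) → ℤ) →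
  sumZ (allVec (suc m)) f ≡ sumZ (allVec m) (λ v → f (false ∷ v) +ℤ f (true ∷ v))
sumZ-allVec m f = go (allVec m)
  where
  go : (vs : List (Vec Bool m)) →
    sumZ (concatMap (λ v → (false ∷ v) ∷ (true ∷ v) ∷ []) vs) f ≡ sumZ vs (λ v → f (false ∷ v) +ℤ f (true ∷ v))
  go []       = refl
  go (v ∷ vs) = trans (cong (λ z → f (false ∷ v) +ℤ (f (true ∷ v) +ℤ z)) (go vs))
                      (sym (ℤ.+-assoc (f (false ∷ v)) (f (true ∷ v)) _))

⊆ᵇ-∷ : {m : ℕ} (a b : Bool) (T S : Vec Bool m) → ((a ∷ T) ⊆ᵇ (b ∷ S)) ≡ ((not a ∨ b) ∧ (T ⊆ᵇ S))
⊆ᵇ-∷ {m} a b T S = cong ((not a ∨ b) ∧_) (all-tabulate m Fin.suc (λ i → not (lookup (a ∷ T) i) ∨ lookup (b ∷ S) i))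

diffCard-∷ : {m : ℕ} (s c : Bool) (S T : Vec Bool m) → diffCard (s ∷ S) (c ∷ T) ≡ ind (s ∧ not c) + diffCard S T
diffCard-∷ {m} s c S T =
  trans (count≡sumL _ (allFin (suc m)))
        (cong (ind (s ∧ not c) +_)
              (trans (sumL-tabulate m Fin.suc (λ i → ind (lookup (s ∷ S) i ∧ not (lookup (c ∷ T) i))))
                     (sym (count≡sumL _ (allFin m)))))

sumOverSubsets : {m : ℕ} → (Vec Bool m → ℕ) → Vec Bool m → ℕ
sumOverSubsets {m} g T = sumL (allVec m) (λ U → ind (U ⊆ᵇ T) * g U)

sumOverSubsets-false∷ : {m : ℕ} (g : Vec Bool (suc m) → ℕ) (T : Vec Bool m) →
  sumOverSubsets g (false ∷ T) ≡ sumOverSubsets (g ∘ (false ∷_)) T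
sumOverSubsets-false∷ {m} g T =
  trans (sumL-allVec m _) (sumL-cong (allVec m) λ U →
    trans (cong₂ (λ p q → ind p * g (false ∷ U) + ind q * g (true ∷ U)) (⊆ᵇ-∷ false false U T) (⊆ᵇ-∷ true false U T))
          (+-identityʳ _))

sumOverSubsets-true∷ : {m : ℕ} (g : Vec Bool (suc m) → ℕ) (T : Vec Bool m) →
  sumOverSubsets g (true ∷ T) ≡ sumOverSubsets (g ∘ (false ∷_)) T + sumOverSubsets (g ∘ (true ∷_)) T
sumOverSubsets-true∷ {m} g T =
  trans (sumL-allVec m _)
    (trans (sumL-cong (allVec m) λ U →
              cong₂ (λ p q → ind p * g (false ∷ U) + ind q * g (true ∷ U)) (⊆ᵇ-∷ false true U T) (⊆ᵇ-∷ true true U T))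
           (sumL-+ (allVec m) _ _))

möbiusWeight : {m : ℕ} → Vec Bool m → Vec Bool m → ℤ
möbiusWeight S T = if T ⊆ᵇ S then -1ℤ ^ diffCard S T else pos 0

möbiusWeight-∷ : {m : ℕ} (s c : Bool) (S T : Vec Bool m) →
  möbiusWeight (s ∷ S) (c ∷ T) ≡ (if (not c ∨ s) ∧ (T ⊆ᵇ S) then -1ℤ ^ (ind (s ∧ not c) + diffCard S T) else pos 0)
möbiusWeight-∷ s c S T = cong₂ (λ b d → if b then -1ℤ ^ d else pos 0) (⊆ᵇ-∷ c s T S) (diffCard-∷ s c S T)

möbiusWeight-ff : {m : ℕ} (S T : Vec Bool m) → möbiusWeight (false ∷ S) (false ∷ T) ≡ möbiusWeight S T
möbiusWeight-ff = möbiusWeight-∷ false false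

möbiusWeight-ft : {m : ℕ} (S T : Vec Bool m) → möbiusWeight (false ∷ S) (true ∷ T) ≡ pos 0
möbiusWeight-ft = möbiusWeight-∷ false true

möbiusWeight-tf : {m : ℕ} (S T : Vec Bool m) → möbiusWeight (true ∷ S) (false ∷ T) ≡ -1ℤ *ℤ möbiusWeight S T
möbiusWeight-tf S T = trans (möbiusWeight-∷ true false S T) (negate (T ⊆ᵇ S))
  where
  negate : ∀ b → (if b then -1ℤ *ℤ -1ℤ ^ diffCard S T else pos 0)
               ≡ -1ℤ *ℤ (if b then -1ℤ ^ diffCard S T else pos 0)
  negate true  = refl
  negate false = refl

möbiusWeight-tt : {m : ℕ} (S T : Vec Bool m) → möbiusWeight (true ∷ S) (true ∷ T) ≡ möbiusWeight S T
möbiusWeight-tt = möbiusWeight-∷ true true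

möbius-inversion : ∀ m (g : Vec Bool m → ℕ) (S : Vec Bool m) →
  sumZ (allVec m) (λ T → möbiusWeight S T *ℤ pos (sumOverSubsets g T)) ≡ pos (g S)
möbius-inversion zero g [] =
  trans (ℤ.+-identityʳ _) (trans (ℤ.*-identityˡ _) (cong pos (trans (+-identityʳ _) (*-identityˡ (g [])))))
möbius-inversion (suc m) g (false ∷ S) =
  trans (sumZ-allVec m _) (trans (sumZ-cong (allVec m) pointwise) (möbius-inversion m (g ∘ (false ∷_)) S))
  where
  pointwise : ∀ T → möbiusWeight (false ∷ S) (false ∷ T) *ℤ pos (sumOverSubsets g (false ∷ T))
                    +ℤ möbiusWeight (false ∷ S) (true ∷ T) *ℤ pos (sumOverSubsets g (true ∷ T))
                  ≡ möbiusWeight S T *ℤ pos (sumOverSubsets (g ∘ (false ∷_)) T)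
  pointwise T rewrite möbiusWeight-ff S T | möbiusWeight-ft S T | sumOverSubsets-false∷ g T =
    ℤ.+-identityʳ _
möbius-inversion (suc m) g (true ∷ S) =
  trans (sumZ-allVec m _) (trans (sumZ-cong (allVec m) pointwise) (möbius-inversion m (g ∘ (true ∷_)) S))
  where
  cancel : ∀ w a b → -1ℤ *ℤ w *ℤ a +ℤ w *ℤ (a +ℤ b) ≡ w *ℤ b
  cancel = ℤ-Ring.solve-∀
  pointwise : ∀ T → möbiusWeight (true ∷ S) (false ∷ T) *ℤ pos (sumOverSubsets g (false ∷ T))
                    +ℤ möbiusWeight (true ∷ S) (true ∷ T) *ℤ pos (sumOverSubsets g (true ∷ T))
                  ≡ möbiusWeight S T *ℤ pos (sumOverSubsets (g ∘ (true ∷_)) T)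
  pointwise T rewrite möbiusWeight-tf S T | möbiusWeight-tt S T
                    | sumOverSubsets-false∷ g T | sumOverSubsets-true∷ g T
                    | ℤ.pos-+ (sumOverSubsets (g ∘ (false ∷_)) T) (sumOverSubsets (g ∘ (true ∷_)) T) =
    cancel (möbiusWeight S T) _ _

flagH-möbius : (P : FiniteGradedPoset) (g : Vec Bool (FiniteGradedPoset.N P ∸ 1) → ℕ) →
  (∀ T → flagF P T ≡ sumOverSubsets g T) → ∀ S → flagH P S ≡ pos (g S)
flagH-möbius P g flagF≡ S =
  trans (sumZ-filter (_⊆ᵇ S) (allVec m) _)
        (trans (sumZ-cong (allVec m) pointwise) (möbius-inversion m g S))
  where
  m : ℕ
  m = FiniteGradedPoset.N P ∸ 1
  pointwise : ∀ T → (if T ⊆ᵇ S then (-1ℤ ^ diffCard S T) *ℤ pos (flagF P T) else pos 0)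
                  ≡ möbiusWeight S T *ℤ pos (sumOverSubsets g T)
  pointwise T rewrite flagF≡ T with T ⊆ᵇ S
  ... | true  = refl
  ... | false = refl

-- Order ideals of 2 × n

<ᵇ-suc : ∀ a b → (a <ᵇ suc b) ≡ (a ≤ᵇ b)
<ᵇ-suc zero    b = refl
<ᵇ-suc (suc a) b = refl

≤Finᵇ-refl : {n : ℕ} (j : Fin n) → (j ≤Finᵇ j) ≡ true
≤Finᵇ-refl j = to-≤ᵇ (≤-refl {toℕ j})

⊆ᵇ⇒ : {m : ℕ} (T S : Vec Bool m) → (T ⊆ᵇ S) ≡ true → ∀ j → lookup T j ≡ true → lookup S j ≡ true
⊆ᵇ⇒ {m} T S T⊆S j Tj with all-allFin⇒ m _ T⊆S j
... | Sj rewrite Tj = Sj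

⊆ᵇ⇐ : {m : ℕ} (T S : Vec Bool m) → (∀ j → lookup T j ≡ true → lookup S j ≡ true) → (T ⊆ᵇ S) ≡ true
⊆ᵇ⇐ {m} T S h = all-allFin⇐ m _ λ j → implies (lookup T j) refl
  where
  implies : ∀ {j} b → b ≡ lookup T j → (not b ∨ lookup S j) ≡ true
  implies false _  = refl
  implies true  Tj = h _ (sym Tj)

allFalse : {n : ℕ} → Vec Bool n → Bool
allFalse []      = true
allFalse (x ∷ u) = not x ∧ allFalse u

-- Prefixes are the vectors true^a false^(n-a), i.e. the order ideals of the chain n.
isPrefixᵇ : {n : ℕ} → Vec Bool n → Bool
isPrefixᵇ []      = true
isPrefixᵇ (x ∷ u) = isPrefixᵇ u ∧ (x ∨ allFalse u)

prefix : (n a : ℕ) → Vec Bool n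
prefix zero    a       = []
prefix (suc n) zero    = false ∷ prefix n zero
prefix (suc n) (suc a) = true ∷ prefix n a

DownClosed : {n : ℕ} → Vec Bool n → Set
DownClosed {n} u = ∀ (j j' : Fin n) → (j' ≤Finᵇ j) ≡ true → lookup u j ≡ true → lookup u j' ≡ true

IsIdeal : {n : ℕ} → SubsetP n → Set
IsIdeal {n} I = ∀ (i : Fin 2) (j : Fin n) (i' : Fin 2) (j' : Fin n) →
  (i' ≤Finᵇ i) ≡ true → (j' ≤Finᵇ j) ≡ true → memP I i j ≡ true → memP I i' j' ≡ true

allFalse⇒ : {n : ℕ} (u : Vec Bool n) → allFalse u ≡ true → ∀ j → lookup u j ≡ false
allFalse⇒ (false ∷ u) e Fin.zero    = refl
allFalse⇒ (false ∷ u) e (Fin.suc j) = allFalse⇒ u e j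
allFalse⇒ (true ∷ u)  () j

allFalse⇐ : {n : ℕ} (u : Vec Bool n) → (∀ j → lookup u j ≡ false) → allFalse u ≡ true
allFalse⇐ []      h = refl
allFalse⇐ (x ∷ u) h rewrite h Fin.zero = allFalse⇐ u (h ∘ Fin.suc)

isPrefixᵇ⇒ : {n : ℕ} (u : Vec Bool n) → isPrefixᵇ u ≡ true → DownClosed u
isPrefixᵇ⇒ (x ∷ u) e Fin.zero      Fin.zero       le m = m
isPrefixᵇ⇒ (x ∷ u) e (Fin.suc j)   Fin.zero       le m with x | ∧-conicalʳ (isPrefixᵇ u) _ e
... | true  | _         = refl
... | false | allFalseu with () ← trans (sym m) (allFalse⇒ u allFalseu j)
isPrefixᵇ⇒ (x ∷ u) e Fin.zero      (Fin.suc j') () m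
isPrefixᵇ⇒ (x ∷ u) e (Fin.suc j)   (Fin.suc j') le m =
  isPrefixᵇ⇒ u (∧-conicalˡ _ _ e) j j' (trans (sym (<ᵇ-suc (toℕ j') (toℕ j))) le) m

isPrefixᵇ⇐ : {n : ℕ} (u : Vec Bool n) → DownClosed u → isPrefixᵇ u ≡ true
isPrefixᵇ⇐ []      h = refl
isPrefixᵇ⇐ (x ∷ u) h =
  ∧-true (isPrefixᵇ⇐ u (λ j j' le m → h (Fin.suc j) (Fin.suc j') (trans (<ᵇ-suc (toℕ j') (toℕ j)) le) m))
         (head-or-allFalse x h)
  where
  head-or-allFalse : ∀ y → DownClosed (y ∷ u) → (y ∨ allFalse u) ≡ true
  head-or-allFalse true  _ = refl
  head-or-allFalse false h = allFalse⇐ u λ j → not-true⇒false λ uj → case h (Fin.suc j) Fin.zero refl uj of λ ()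

isIdealᵇ⇒ : {n : ℕ} (I : SubsetP n) → isIdealᵇ I ≡ true → IsIdeal I
isIdealᵇ⇒ {n} I e i j i' j' i'≤i j'≤j Iij =
  modusPonens (all-allFin⇒ n (closed i j i') (all-allFin⇒ 2 (λ i' → all (closed i j i') (allFin n))
    (all-allFin⇒ n (λ j → all (λ i' → all (closed i j i') (allFin n)) (allFin 2))
      (all-allFin⇒ 2 (λ i → all (λ j → all (λ i' → all (closed i j i') (allFin n)) (allFin 2)) (allFin n)) e i) j) i') j')
  where
  closed : Fin 2 → Fin n → Fin 2 → Fin n → Bool
  closed i j i' j' = not ((i' ≤Finᵇ i) ∧ (j' ≤Finᵇ j) ∧ memP I i j) ∨ memP I i' j'
  modusPonens : (not ((i' ≤Finᵇ i) ∧ (j' ≤Finᵇ j) ∧ memP I i j) ∨ memP I i' j') ≡ true → memP I i' j' ≡ true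
  modusPonens rewrite i'≤i | j'≤j | Iij = id

isIdealᵇ⇐ : {n : ℕ} (I : SubsetP n) → IsIdeal I → isIdealᵇ I ≡ true
isIdealᵇ⇐ {n} I h = all-allFin⇐ 2 _ λ i → all-allFin⇐ n _ λ j → all-allFin⇐ 2 _ λ i' → all-allFin⇐ n _ λ j' →
  implication (i' ≤Finᵇ i) (j' ≤Finᵇ j) (memP I i j) (memP I i' j') (h i j i' j')
  where
  implication : ∀ a b c d → (a ≡ true → b ≡ true → c ≡ true → d ≡ true) → (not (a ∧ b ∧ c) ∨ d) ≡ true
  implication true  true  true  d k = k refl refl refl
  implication false b     c     d k = refl
  implication true  false c     d k = refl
  implication true  true  false d k = refl

isIdealᵇ-rows : {n : ℕ} (u v : Vec Bool n) → isIdealᵇ (u ∷ v ∷ []) ≡ (isPrefixᵇ u ∧ isPrefixᵇ v) ∧ (v ⊆ᵇ u)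
isIdealᵇ-rows u v = bool-ext
  (λ e → let ideal = isIdealᵇ⇒ (u ∷ v ∷ []) e in
    ∧-true (∧-true (isPrefixᵇ⇐ u (λ j j' → ideal Fin.zero j Fin.zero j' refl))
                   (isPrefixᵇ⇐ v (λ j j' → ideal (Fin.suc Fin.zero) j (Fin.suc Fin.zero) j' refl)))
           (⊆ᵇ⇐ v u (λ j → ideal (Fin.suc Fin.zero) j Fin.zero j refl (≤Finᵇ-refl j))))
  (λ e → let prefixes = ∧-conicalˡ (isPrefixᵇ u ∧ isPrefixᵇ v) (v ⊆ᵇ u) e in
    isIdealᵇ⇐ (u ∷ v ∷ []) (rows-ideal (∧-conicalˡ (isPrefixᵇ u) (isPrefixᵇ v) prefixes)
                                       (∧-conicalʳ (isPrefixᵇ u) (isPrefixᵇ v) prefixes)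
                                       (∧-conicalʳ (isPrefixᵇ u ∧ isPrefixᵇ v) (v ⊆ᵇ u) e)))
  where
  rows-ideal : isPrefixᵇ u ≡ true → isPrefixᵇ v ≡ true → (v ⊆ᵇ u) ≡ true → IsIdeal (u ∷ v ∷ [])
  rows-ideal pu pv v⊆u Fin.zero               j Fin.zero               j' _  le m = isPrefixᵇ⇒ u pu j j' le m
  rows-ideal pu pv v⊆u (Fin.suc Fin.zero) j (Fin.suc Fin.zero) j' _  le m = isPrefixᵇ⇒ v pv j j' le m
  rows-ideal pu pv v⊆u (Fin.suc Fin.zero) j Fin.zero               j' _  le m = ⊆ᵇ⇒ v u v⊆u j' (isPrefixᵇ⇒ v pv j j' le m)
  rows-ideal pu pv v⊆u Fin.zero               j (Fin.suc Fin.zero) j' () le m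

isPrefixᵇ-allFalse : {n : ℕ} (u : Vec Bool n) → (isPrefixᵇ u ∧ allFalse u) ≡ allFalse u
isPrefixᵇ-allFalse []          = refl
isPrefixᵇ-allFalse (true ∷ u)  = ∧-zeroʳ _
isPrefixᵇ-allFalse (false ∷ u) =
  trans (cong (_∧ allFalse u) (isPrefixᵇ-allFalse u)) (∧-idem (allFalse u))

sumL-allFalse : ∀ n (k : Vec Bool n → ℕ) → sumL (allVec n) (λ u → ind (allFalse u) * k u) ≡ k (prefix n 0)
sumL-allFalse zero    k = trans (+-identityʳ _) (+-identityʳ _)
sumL-allFalse (suc n) k =
  trans (sumL-allVec n _)
        (trans (sumL-cong (allVec n) (λ u → +-identityʳ _)) (sumL-allFalse n (k ∘ (false ∷_))))

sumL-isPrefixᵇ : ∀ n (k : Vec Bool n → ℕ) → sumL (allVec n) (λ u → ind (isPrefixᵇ u) * k u) ≡ Σ< (suc n) (k ∘ prefix n)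
sumL-isPrefixᵇ zero    k = trans (+-identityʳ _) (+-identityʳ _)
sumL-isPrefixᵇ (suc n) k = begin
  sumL (allVec (suc n)) (λ u → ind (isPrefixᵇ u) * k u)
    ≡⟨ sumL-allVec n _ ⟩
  sumL (allVec n) (λ u → ind (isPrefixᵇ u ∧ allFalse u) * k (false ∷ u) + ind (isPrefixᵇ u ∧ true) * k (true ∷ u))
    ≡⟨ sumL-+ (allVec n) _ _ ⟩
  sumL (allVec n) (λ u → ind (isPrefixᵇ u ∧ allFalse u) * k (false ∷ u))
  + sumL (allVec n) (λ u → ind (isPrefixᵇ u ∧ true) * k (true ∷ u))
    ≡⟨ cong₂ _+_ (sumL-cong (allVec n) (λ u → cong (λ b → ind b * k (false ∷ u)) (isPrefixᵇ-allFalse u)))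
                 (sumL-cong (allVec n) (λ u → cong (λ b → ind b * k (true ∷ u)) (∧-identityʳ (isPrefixᵇ u)))) ⟩
  sumL (allVec n) (λ u → ind (allFalse u) * k (false ∷ u)) + sumL (allVec n) (λ u → ind (isPrefixᵇ u) * k (true ∷ u))
    ≡⟨ cong₂ _+_ (sumL-allFalse n (k ∘ (false ∷_))) (sumL-isPrefixᵇ n (k ∘ (true ∷_))) ⟩
  k (prefix (suc n) 0) + Σ< (suc n) (k ∘ prefix (suc n) ∘ suc)
    ≡⟨ Σ<-shift (suc n) (k ∘ prefix (suc n)) ⟨
  Σ< (suc (suc n)) (k ∘ prefix (suc n)) ∎
  where open ≡-Reasoning

prefix-⊆ᵇ : ∀ n a b → a ≤ n → b ≤ n → (prefix n b ⊆ᵇ prefix n a) ≡ (b ≤ᵇ a)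
prefix-⊆ᵇ zero    zero    zero    _         _         = refl
prefix-⊆ᵇ (suc n) zero    zero    _         _         = trans (⊆ᵇ-∷ false false (prefix n 0) _) (prefix-⊆ᵇ n 0 0 z≤n z≤n)
prefix-⊆ᵇ (suc n) (suc a) zero    (s≤s a≤n) _         = trans (⊆ᵇ-∷ false true (prefix n 0) _) (prefix-⊆ᵇ n a 0 a≤n z≤n)
prefix-⊆ᵇ (suc n) zero    (suc b) _         _         = ⊆ᵇ-∷ true false (prefix n b) (prefix n 0)
prefix-⊆ᵇ (suc n) (suc a) (suc b) (s≤s a≤n) (s≤s b≤n) =
  trans (⊆ᵇ-∷ true true (prefix n b) _) (trans (prefix-⊆ᵇ n a b a≤n b≤n) (sym (<ᵇ-suc b a)))

ideal : (n a b : ℕ) → SubsetP n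
ideal n a b = prefix n a ∷ prefix n b ∷ []

sumL-allVecsOf-2 : {A : Set} (xs : List A) (f : Vec A 2 → ℕ) →
  sumL (allVecsOf 2 xs) f ≡ sumL xs (λ v → sumL xs (λ u → f (u ∷ v ∷ [])))
sumL-allVecsOf-2 {A} xs f =
  trans (sumL-concatMap (extend {1}) (allVecsOf 1 xs) f)
  (trans (sumL-concatMap (extend {0}) ([] ∷ []) (λ ys → sumL (extend ys) f))
  (trans (+-identityʳ _)
  (trans (sumL-map (λ x → x ∷ []) xs (λ ys → sumL (extend ys) f))
         (sumL-cong xs (λ v → sumL-map (λ x → x ∷ v ∷ []) xs f)))))
  where
  extend : {l : ℕ} → Vec A l → List (Vec A (suc l))
  extend ys = map (λ x → x ∷ ys) xs

Σ² : ℕ → (ℕ → ℕ → ℕ) → ℕ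
Σ² n f = Σ< (suc n) (λ b → Σ< (suc n) (λ a → f a b))

Σ²-cong : ∀ n {f g : ℕ → ℕ → ℕ} → (∀ a b → a ≤ n → b ≤ n → f a b ≡ g a b) → Σ² n f ≡ Σ² n g
Σ²-cong n e = Σ<-cong (suc n) (λ b b< → Σ<-cong (suc n) (λ a a< → e a b (≤-pred a<) (≤-pred b<)))

ideals : (n : ℕ) → List (SubsetP n)
ideals n = filterᵇ isIdealᵇ (allSubsetsP n)

sumL-ideals : ∀ n (h : SubsetP n → ℕ) →
  sumL (ideals n) h ≡ Σ² n (λ a b → ind (b ≤ᵇ a) * h (ideal n a b))
sumL-ideals n h = begin
  sumL (ideals n) h
    ≡⟨ sumL-filter isIdealᵇ (allSubsetsP n) h ⟩
  sumL (allSubsetsP n) (λ I → ind (isIdealᵇ I) * h I)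
    ≡⟨ sumL-allVecsOf-2 (allVec n) _ ⟩
  sumL (allVec n) (λ v → sumL (allVec n) (λ u → ind (isIdealᵇ (u ∷ v ∷ [])) * h (u ∷ v ∷ [])))
    ≡⟨ sumL-cong (allVec n) (λ v → trans (sumL-cong (allVec n) (λ u → factor u v)) (sym (sumL-*ˡ (ind (isPrefixᵇ v)) (allVec n) _))) ⟩
  sumL (allVec n) (λ v → ind (isPrefixᵇ v) * sumL (allVec n) (λ u → ind (isPrefixᵇ u) * (ind (v ⊆ᵇ u) * h (u ∷ v ∷ []))))
    ≡⟨ sumL-cong (allVec n) (λ v → cong (ind (isPrefixᵇ v) *_) (sumL-isPrefixᵇ n _)) ⟩
  sumL (allVec n) (λ v → ind (isPrefixᵇ v) * Σ< (suc n) (λ a → ind (v ⊆ᵇ prefix n a) * h (prefix n a ∷ v ∷ [])))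
    ≡⟨ sumL-isPrefixᵇ n _ ⟩
  Σ² n (λ a b → ind (prefix n b ⊆ᵇ prefix n a) * h (ideal n a b))
    ≡⟨ Σ²-cong n (λ a b a≤n b≤n → cong (λ c → ind c * h (ideal n a b)) (prefix-⊆ᵇ n a b a≤n b≤n)) ⟩
  Σ² n (λ a b → ind (b ≤ᵇ a) * h (ideal n a b)) ∎
  where
  open ≡-Reasoning
  factor : ∀ u v → ind (isIdealᵇ (u ∷ v ∷ [])) * h (u ∷ v ∷ [])
                 ≡ ind (isPrefixᵇ v) * (ind (isPrefixᵇ u) * (ind (v ⊆ᵇ u) * h (u ∷ v ∷ [])))
  factor u v rewrite isIdealᵇ-rows u v with isPrefixᵇ u | isPrefixᵇ v | v ⊆ᵇ u
  ... | true  | true  | c = sym (trans (*-identityˡ _) (*-identityˡ _))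
  ... | true  | false | c = refl
  ... | false | true  | c = refl
  ... | false | false | c = refl

prefix-zero-⊆ᵇ : {n : ℕ} (v : Vec Bool n) → (prefix n 0 ⊆ᵇ v) ≡ true
prefix-zero-⊆ᵇ []      = refl
prefix-zero-⊆ᵇ (x ∷ v) = trans (⊆ᵇ-∷ false x (prefix _ 0) v) (prefix-zero-⊆ᵇ v)

inclᵇ-ideal : ∀ n a b a' b' → a ≤ n → b ≤ n → a' ≤ n → b' ≤ n →
  inclᵇ (ideal n a b) (ideal n a' b') ≡ ((a ≤ᵇ a') ∧ (b ≤ᵇ b'))
inclᵇ-ideal n a b a' b' a≤n b≤n a'≤n b'≤n =
  trans (cong₂ (λ p q → p ∧ (q ∧ true)) (prefix-⊆ᵇ n a' a a'≤n a≤n) (prefix-⊆ᵇ n b' b b'≤n b≤n))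
        (cong ((a ≤ᵇ a') ∧_) (∧-identityʳ _))

inclᵇ-empty : ∀ n (I : SubsetP n) → inclᵇ (ideal n 0 0) I ≡ true
inclᵇ-empty n (u ∷ v ∷ []) = cong₂ (λ p q → p ∧ (q ∧ true)) (prefix-zero-⊆ᵇ u) (prefix-zero-⊆ᵇ v)

sumL-allFin-suc : ∀ n (f : Fin (suc n) → ℕ) → sumL (allFin (suc n)) f ≡ f Fin.zero + sumL (allFin n) (f ∘ Fin.suc)
sumL-allFin-suc n f = cong (f Fin.zero +_) (sumL-tabulate n Fin.suc f)

count-prefix : ∀ n a → a ≤ n → sumL (allFin n) (λ j → ind (lookup (prefix n a) j)) ≡ a
count-prefix zero    zero    _         = refl
count-prefix (suc n) zero    _         =
  trans (sumL-allFin-suc n (λ j → ind (lookup (prefix (suc n) 0) j))) (count-prefix n zero z≤n)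
count-prefix (suc n) (suc a) (s≤s a≤n) =
  trans (sumL-allFin-suc n (λ j → ind (lookup (prefix (suc n) (suc a)) j))) (cong suc (count-prefix n a a≤n))

cardP-ideal : ∀ n a b → a ≤ n → b ≤ n → cardP (ideal n a b) ≡ a + b
cardP-ideal n a b a≤n b≤n = begin
  cardP (ideal n a b)
    ≡⟨ count≡sumL _ (concatMap cells (allFin 2)) ⟩
  sumL (concatMap cells (allFin 2)) (λ ij → ind (memP (ideal n a b) (proj₁ ij) (proj₂ ij)))
    ≡⟨ sumL-concatMap cells (allFin 2) _ ⟩
  sumL (cells Fin.zero) _ + (sumL (cells (Fin.suc Fin.zero)) _ + 0)
    ≡⟨ cong₂ (λ x y → x + (y + 0)) (trans (sumL-map _ (allFin n) _) (count-prefix n a a≤n))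
                                   (trans (sumL-map _ (allFin n) _) (count-prefix n b b≤n)) ⟩
  a + (b + 0)
    ≡⟨ cong (a +_) (+-identityʳ b) ⟩
  a + b ∎
  where
  open ≡-Reasoning
  cells : Fin 2 → List (Fin 2 × Fin n)
  cells i = map (λ j → (i , j)) (allFin n)

-- Chains of ideals

-- chainCount n a b ts counts the chains (a₁,b₁) ⊆ (a₂,b₂) ⊆ ⋯ of ideals of 2 × n
-- (row lengths aᵢ ≥ bᵢ) lying above (a,b), whose ranks aᵢ + bᵢ are the entries of ts.
chainCount : ℕ → ℕ → ℕ → List ℕ → ℕ
chainCount n a b []       = 1
chainCount n a b (t ∷ ts) =
  Σ² n (λ a' b' → ind (b' ≤ᵇ a') * (ind ((a' + b' ≡ᵇ t) ∧ ((a ≤ᵇ a') ∧ (b ≤ᵇ b'))) * chainCount n a' b' ts))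

ind-∧-∧ : ∀ p q r s → ind ((p ∧ q) ∧ (r ∧ s)) ≡ ind (p ∧ r) * ind (q ∧ s)
ind-∧-∧ true  true  true  true  = refl
ind-∧-∧ true  true  true  false = refl
ind-∧-∧ true  true  false s     = refl
ind-∧-∧ true  false true  s     = refl
ind-∧-∧ true  false false s     = refl
ind-∧-∧ false q     r     s     = refl

chainCount-lists : ∀ n (ts : List ℕ) a b → a ≤ n → b ≤ n →
  sumL (allLists (length ts) (ideals n)) (λ c → ind (eqListℕ (map cardP c) ts ∧ consecutive inclᵇ (ideal n a b ∷ c)))
    ≡ chainCount n a b ts
chainCount-lists n []       a b _   _   = refl
chainCount-lists n (t ∷ ts) a b a≤n b≤n = begin
  sumL (allLists (suc l) E) F
    ≡⟨ sumL-concatMap (λ ys → map (_∷ ys) E) (allLists l E) F ⟩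
  sumL (allLists l E) (λ ys → sumL (map (_∷ ys) E) F)
    ≡⟨ sumL-cong (allLists l E) (λ ys → sumL-map (_∷ ys) E F) ⟩
  sumL (allLists l E) (λ ys → sumL E (λ I → F (I ∷ ys)))
    ≡⟨ sumL-swap (allLists l E) E (λ ys I → F (I ∷ ys)) ⟩
  sumL E (λ I → sumL (allLists l E) (λ ys → F (I ∷ ys)))
    ≡⟨ sumL-cong E (λ I → trans (sumL-cong (allLists l E) (λ ys → ind-∧-∧ (cardP I ≡ᵇ t) _ (inclᵇ (ideal n a b) I) _))
                                (sym (sumL-*ˡ (ind ((cardP I ≡ᵇ t) ∧ inclᵇ (ideal n a b) I)) (allLists l E) _))) ⟩
  sumL E (λ I → ind ((cardP I ≡ᵇ t) ∧ inclᵇ (ideal n a b) I) * sumL (allLists l E) (λ c → G I c))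
    ≡⟨ sumL-ideals n _ ⟩
  Σ² n (λ a' b' → ind (b' ≤ᵇ a') * (ind ((cardP (ideal n a' b') ≡ᵇ t) ∧ inclᵇ (ideal n a b) (ideal n a' b'))
                                     * sumL (allLists l E) (G (ideal n a' b'))))
    ≡⟨ Σ²-cong n (λ a' b' a'≤n b'≤n → cong (ind (b' ≤ᵇ a') *_) (cong₂ _*_
         (cong ind (cong₂ _∧_ (cong (_≡ᵇ t) (cardP-ideal n a' b' a'≤n b'≤n)) (inclᵇ-ideal n a b a' b' a≤n b≤n a'≤n b'≤n)))
         (chainCount-lists n ts a' b' a'≤n b'≤n))) ⟩
  chainCount n a b (t ∷ ts) ∎
  where
  open ≡-Reasoning
  E : List (SubsetP n)
  E = ideals n
  l : ℕ
  l = length ts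
  F : List (SubsetP n) → ℕ
  F c = ind (eqListℕ (map cardP c) (t ∷ ts) ∧ consecutive inclᵇ (ideal n a b ∷ c))
  G : SubsetP n → List (SubsetP n) → ℕ
  G I c = ind (eqListℕ (map cardP c) ts ∧ consecutive inclᵇ (I ∷ c))

flagF≡chainCount : ∀ n (T : Subset (2 * n ∸ 1)) → flagF (J2×n n) T ≡ chainCount n 0 0 (elems T)
flagF≡chainCount n T = begin
  flagF (J2×n n) T
    ≡⟨ count≡sumL _ (allLists (length (elems T)) (ideals n)) ⟩
  sumL (allLists (length (elems T)) (ideals n)) (λ c → ind (eqListℕ (map cardP c) (elems T) ∧ consecutive inclᵇ c))
    ≡⟨ sumL-cong (allLists (length (elems T)) (ideals n))
                 (λ c → cong (λ z → ind (eqListℕ (map cardP c) (elems T) ∧ z)) (from-empty c)) ⟩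
  sumL (allLists (length (elems T)) (ideals n))
       (λ c → ind (eqListℕ (map cardP c) (elems T) ∧ consecutive inclᵇ (ideal n 0 0 ∷ c)))
    ≡⟨ chainCount-lists n (elems T) 0 0 z≤n z≤n ⟩
  chainCount n 0 0 (elems T) ∎
  where
  open ≡-Reasoning
  from-empty : ∀ c → consecutive inclᵇ c ≡ consecutive inclᵇ (ideal n 0 0 ∷ c)
  from-empty []      = refl
  from-empty (I ∷ c) rewrite inclᵇ-empty n I = refl

-- Two-column tableaux

rowAbove : ℕ → ℕ → ℕ → ℕ → ℕ → Bool
rowAbove n x y u v = (((1 ≤ᵇ u) ∧ (u ≤ᵇ v)) ∧ ((u <ᵇ n) ∧ (v <ᵇ n))) ∧ ((x <ᵇ u) ∧ (y <ᵇ v))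

-- tableauCount n x y ss counts the semistandard fillings of ⟨2^k⟩ with entries in [1, n-1]
-- and row sums ss, placed under a row (x, y).
tableauCount : ℕ → ℕ → ℕ → List ℕ → ℕ
tableauCount n x y []       = 1
tableauCount n x y (s ∷ ss) =
  Σ< n (λ u → Σ< n (λ v → ind ((u + v ≡ᵇ s) ∧ rowAbove n x y u v) * tableauCount n u v ss))

-- subTableauCount n x y ts is the sum of tableauCount n x y over the sublists of ts.
subTableauCount : ℕ → ℕ → ℕ → List ℕ → ℕ
subTableauCount n x y []       = 1
subTableauCount n x y (t ∷ ts) =
  subTableauCount n x y ts
  + Σ< n (λ u → Σ< n (λ v → ind ((u + v ≡ᵇ t) ∧ rowAbove n x y u v) * subTableauCount n u v ts))

elemsFrom : {m : ℕ} → ℕ → Vec Bool m → List ℕ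
elemsFrom r []          = []
elemsFrom r (true ∷ v)  = r ∷ elemsFrom (suc r) v
elemsFrom r (false ∷ v) = elemsFrom (suc r) v

map-filter-tabulate≡elemsFrom : ∀ m {k} (S : Vec Bool m) (g : Fin m → Fin k) (p : Fin k → Bool) (f : Fin k → ℕ) r →
  (∀ i → p (g i) ≡ lookup S i) → (∀ i → f (g i) ≡ r + toℕ i) → map f (filterᵇ p (tabulate g)) ≡ elemsFrom r S
map-filter-tabulate≡elemsFrom zero    []      g p f r hp hf = refl
map-filter-tabulate≡elemsFrom (suc m) (x ∷ S) g p f r hp hf with p (g Fin.zero) | hp Fin.zero
... | true  | refl = cong₂ _∷_ (trans (hf Fin.zero) (+-identityʳ r)) tail≡
  where
  tail≡ : map f (filterᵇ p (tabulate (g ∘ Fin.suc))) ≡ elemsFrom (suc r) S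
  tail≡ = map-filter-tabulate≡elemsFrom m S (g ∘ Fin.suc) p f (suc r) (hp ∘ Fin.suc)
            (λ i → trans (hf (Fin.suc i)) (+-suc r (toℕ i)))
... | false | refl = map-filter-tabulate≡elemsFrom m S (g ∘ Fin.suc) p f (suc r) (hp ∘ Fin.suc)
                      (λ i → trans (hf (Fin.suc i)) (+-suc r (toℕ i)))

elems≡elemsFrom : {m : ℕ} (S : Vec Bool m) → elems S ≡ elemsFrom 1 S
elems≡elemsFrom {m} S = map-filter-tabulate≡elemsFrom m S id (lookup S) (suc ∘ toℕ) 1 (λ _ → refl) (λ _ → refl)

elemsFrom-increasing : ∀ {m} r' r → r' < r → (S : Vec Bool m) → Linked _<_ (r' ∷ elemsFrom r S)
elemsFrom-increasing r' r r'<r []          = [-]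
elemsFrom-increasing r' r r'<r (true ∷ S)  = r'<r ∷ elemsFrom-increasing r (suc r) (n<1+n r) S
elemsFrom-increasing r' r r'<r (false ∷ S) = elemsFrom-increasing r' (suc r) (m<n⇒m<1+n r'<r) S

elemsFrom-bounded : ∀ {m} r (S : Vec Bool m) {z} → z ∈ elemsFrom r S → z < r + m
elemsFrom-bounded {suc m} r (true ∷ S)  (here refl) = subst (r <_) (sym (+-suc r m)) (m≤m+n (suc r) m)
elemsFrom-bounded {suc m} r (true ∷ S)  {z} (there z∈) = subst (z <_) (sym (+-suc r m)) (elemsFrom-bounded (suc r) S z∈)
elemsFrom-bounded {suc m} r (false ∷ S) {z} z∈ = subst (z <_) (sym (+-suc r m)) (elemsFrom-bounded (suc r) S z∈)

length-elemsFrom : ∀ {m} r (S : Vec Bool m) → length (elemsFrom r S) ≡ ∣ S ∣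
length-elemsFrom r []          = refl
length-elemsFrom r (true ∷ S)  = cong suc (length-elemsFrom (suc r) S)
length-elemsFrom r (false ∷ S) = length-elemsFrom (suc r) S

sumOverSubsets-Σ<² : ∀ {m} n (c : ℕ → ℕ → ℕ) (f : ℕ → ℕ → Vec Bool m → ℕ) (T : Vec Bool m) →
  sumOverSubsets (λ U → Σ< n (λ u → Σ< n (λ v → c u v * f u v U))) T
    ≡ Σ< n (λ u → Σ< n (λ v → c u v * sumOverSubsets (f u v) T))
sumOverSubsets-Σ<² {m} n c f T = begin
  sumL (allVec m) (λ U → ind (U ⊆ᵇ T) * Σ< n (λ u → Σ< n (λ v → c u v * f u v U)))
    ≡⟨ sumL-cong (allVec m) (λ U → trans (Σ<-*ˡ (ind (U ⊆ᵇ T)) n _) (Σ<-cong n (λ u _ → trans (Σ<-*ˡ (ind (U ⊆ᵇ T)) n _)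
                                      (Σ<-cong n (λ v _ → *-swap (ind (U ⊆ᵇ T)) (c u v) (f u v U)))))) ⟩
  sumL (allVec m) (λ U → Σ< n (λ u → Σ< n (λ v → c u v * (ind (U ⊆ᵇ T) * f u v U))))
    ≡⟨ sumL-Σ< (allVec m) n _ ⟩
  Σ< n (λ u → sumL (allVec m) (λ U → Σ< n (λ v → c u v * (ind (U ⊆ᵇ T) * f u v U))))
    ≡⟨ Σ<-cong n (λ u _ → trans (sumL-Σ< (allVec m) n _) (Σ<-cong n (λ v _ → sym (sumL-*ˡ (c u v) (allVec m) _)))) ⟩
  Σ< n (λ u → Σ< n (λ v → c u v * sumOverSubsets (f u v) T)) ∎
  where
  open ≡-Reasoning
  *-swap : ∀ a b c → a * (b * c) ≡ b * (a * c)
  *-swap = ℕ-Ring.solve-∀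

subTableauCount≡sumOverSubsets : ∀ n {m} r (T : Vec Bool m) x y →
  subTableauCount n x y (elemsFrom r T) ≡ sumOverSubsets (λ U → tableauCount n x y (elemsFrom r U)) T
subTableauCount≡sumOverSubsets n r []          x y = refl
subTableauCount≡sumOverSubsets n r (false ∷ T) x y =
  trans (subTableauCount≡sumOverSubsets n (suc r) T x y)
        (sym (sumOverSubsets-false∷ (λ U → tableauCount n x y (elemsFrom r U)) T))
subTableauCount≡sumOverSubsets n r (true ∷ T) x y = begin
  subTableauCount n x y (elemsFrom (suc r) T)
  + Σ< n (λ u → Σ< n (λ v → c u v * subTableauCount n u v (elemsFrom (suc r) T)))
    ≡⟨ cong₂ _+_ (subTableauCount≡sumOverSubsets n (suc r) T x y)
                 (Σ<-cong n (λ u _ → Σ<-cong n (λ v _ → cong (c u v *_) (subTableauCount≡sumOverSubsets n (suc r) T u v)))) ⟩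
  sumOverSubsets (λ U → tableauCount n x y (elemsFrom (suc r) U)) T
  + Σ< n (λ u → Σ< n (λ v → c u v * sumOverSubsets (λ U → tableauCount n u v (elemsFrom (suc r) U)) T))
    ≡⟨ cong (sumOverSubsets (λ U → tableauCount n x y (elemsFrom (suc r) U)) T +_)
            (sym (sumOverSubsets-Σ<² n c (λ u v U → tableauCount n u v (elemsFrom (suc r) U)) T)) ⟩
  sumOverSubsets (λ U → tableauCount n x y (elemsFrom (suc r) U)) T
  + sumOverSubsets (λ U → tableauCount n x y (r ∷ elemsFrom (suc r) U)) T
    ≡⟨ sumOverSubsets-true∷ (λ U → tableauCount n x y (elemsFrom r U)) T ⟨
  sumOverSubsets (λ U → tableauCount n x y (elemsFrom r U)) (true ∷ T) ∎
  where
  open ≡-Reasoning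
  c : ℕ → ℕ → ℕ
  c u v = ind ((u + v ≡ᵇ r) ∧ rowAbove n x y u v)

goodRowᵇ : ℕ × ℕ → Bool
goodRowᵇ r = (1 ≤ᵇ proj₁ r) ∧ (proj₁ r ≤ᵇ proj₂ r)

rowEntriesBelowᵇ : ℕ → ℕ × ℕ → Bool
rowEntriesBelowᵇ n r = (proj₁ r <ᵇ n) ∧ (proj₂ r <ᵇ n)

columnsIncreaseᵇ : ℕ × ℕ → ℕ × ℕ → Bool
columnsIncreaseᵇ r r' = (proj₁ r <ᵇ proj₁ r') ∧ (proj₂ r <ᵇ proj₂ r')

tableauUnderᵇ : ℕ → ℕ × ℕ → List (ℕ × ℕ) → Bool
tableauUnderᵇ n r rows = (all goodRowᵇ rows ∧ all (rowEntriesBelowᵇ n) rows) ∧ consecutive columnsIncreaseᵇ (r ∷ rows)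

rowCandidates : ℕ → List (ℕ × ℕ)
rowCandidates n = concatMap (λ a → map (λ b → (a , b)) (range n)) (range n)

sumL-rowCandidates : ∀ n (h : ℕ × ℕ → ℕ) → sumL (rowCandidates n) h ≡ Σ< n (λ a → Σ< n (λ b → h (a , b)))
sumL-rowCandidates n h =
  trans (sumL-concatMap _ (range n) h)
  (trans (sumL-cong (range n) (λ a → trans (sumL-map _ (range n) h) (sumL-range n (λ b → h (a , b)))))
         (sumL-range n (λ a → Σ< n (λ b → h (a , b)))))

tableauCount-enumeration : ∀ n (ss : List ℕ) x y →
  sumL (allVecsOf (length ss) (rowCandidates n)) (λ T → ind (tableauUnderᵇ n (x , y) (toList T) ∧ eqListℕ (rowSums T) ss))
    ≡ tableauCount n x y ss
tableauCount-enumeration n []       x y = refl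
tableauCount-enumeration n (s ∷ ss) x y = begin
  sumL (allVecsOf (suc l) R) F
    ≡⟨ sumL-concatMap (λ ys → map (λ r → r ∷ ys) R) (allVecsOf l R) F ⟩
  sumL (allVecsOf l R) (λ ys → sumL (map (λ r → r ∷ ys) R) F)
    ≡⟨ sumL-cong (allVecsOf l R) (λ ys → sumL-map (λ r → r ∷ ys) R F) ⟩
  sumL (allVecsOf l R) (λ ys → sumL R (λ r → F (r ∷ ys)))
    ≡⟨ sumL-swap (allVecsOf l R) R (λ ys r → F (r ∷ ys)) ⟩
  sumL R (λ r → sumL (allVecsOf l R) (λ ys → F (r ∷ ys)))
    ≡⟨ sumL-cong R (λ r → trans (sumL-cong (allVecsOf l R) (first-row r)) (sym (sumL-*ˡ (c r) (allVecsOf l R) (G r)))) ⟩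
  sumL R (λ r → c r * sumL (allVecsOf l R) (G r))
    ≡⟨ sumL-rowCandidates n _ ⟩
  Σ< n (λ u → Σ< n (λ v → c (u , v) * sumL (allVecsOf l R) (G (u , v))))
    ≡⟨ Σ<-cong n (λ u _ → Σ<-cong n (λ v _ → cong (c (u , v) *_) (tableauCount-enumeration n ss u v))) ⟩
  tableauCount n x y (s ∷ ss) ∎
  where
  open ≡-Reasoning
  R : List (ℕ × ℕ)
  R = rowCandidates n
  l : ℕ
  l = length ss
  F : Vec (ℕ × ℕ) (suc l) → ℕ
  F T = ind (tableauUnderᵇ n (x , y) (toList T) ∧ eqListℕ (rowSums T) (s ∷ ss))
  c : ℕ × ℕ → ℕ
  c r = ind ((proj₁ r + proj₂ r ≡ᵇ s) ∧ rowAbove n x y (proj₁ r) (proj₂ r))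
  G : ℕ × ℕ → Vec (ℕ × ℕ) l → ℕ
  G r ys = ind (tableauUnderᵇ n r (toList ys) ∧ eqListℕ (rowSums ys) ss)
  rearrange : ∀ A B C D E F G H → ((((A ∧ B) ∧ (C ∧ D)) ∧ (E ∧ F)) ∧ (G ∧ H)) ≡ ((G ∧ ((A ∧ C) ∧ E)) ∧ (((B ∧ D) ∧ F) ∧ H))
  rearrange = solve 8 (λ A B C D E F G H → ((((A :* B) :* (C :* D)) :* (E :* F)) :* (G :* H))
                                         := ((G :* ((A :* C) :* E)) :* (((B :* D) :* F) :* H))) refl
  first-row : ∀ r ys → F (r ∷ ys) ≡ c r * G r ys
  first-row r ys = trans
    (cong ind (rearrange (goodRowᵇ r) (all goodRowᵇ (toList ys)) (rowEntriesBelowᵇ n r) (all (rowEntriesBelowᵇ n) (toList ys))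
                         (columnsIncreaseᵇ (x , y) r) (consecutive columnsIncreaseᵇ (r ∷ toList ys))
                         (proj₁ r + proj₂ r ≡ᵇ s) (eqListℕ (rowSums ys) ss)))
    (ind-∧ ((proj₁ r + proj₂ r ≡ᵇ s) ∧ rowAbove n x y (proj₁ r) (proj₂ r)) (tableauUnderᵇ n r (toList ys) ∧ eqListℕ (rowSums ys) ss))

all⇒ : {A : Set} (p : A → Bool) (xs : List A) → all p xs ≡ true → ∀ {z} → z ∈ xs → p z ≡ true
all⇒ p (x ∷ xs) e (here refl) = ∧-conicalˡ (p x) _ e
all⇒ p (x ∷ xs) e (there z∈)  = all⇒ p xs (∧-conicalʳ (p x) _ e) z∈

⇒all : {A : Set} (p : A → Bool) (xs : List A) → (∀ {z} → z ∈ xs → p z ≡ true) → all p xs ≡ true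
⇒all p []       h = refl
⇒all p (x ∷ xs) h = ∧-true (h (here refl)) (⇒all p xs (h ∘ there))

any-≡ᵇ⇒∈ : ∀ z (ys : List ℕ) → any (λ y → z ≡ᵇ y) ys ≡ true → z ∈ ys
any-≡ᵇ⇒∈ z (y ∷ ys) e with z ≡ᵇ y in z≡ᵇy
... | true  = here (from-≡ᵇ z≡ᵇy)
... | false = there (any-≡ᵇ⇒∈ z ys e)

∈⇒any-≡ᵇ : ∀ z (ys : List ℕ) → z ∈ ys → any (λ y → z ≡ᵇ y) ys ≡ true
∈⇒any-≡ᵇ z (y ∷ ys) (here refl) rewrite ≡ᵇ-refl z = refl
∈⇒any-≡ᵇ z (y ∷ ys) (there z∈) with z ≡ᵇ y
... | true  = refl
... | false = ∈⇒any-≡ᵇ z ys z∈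

eqListℕ⇒≡ : ∀ xs ys → eqListℕ xs ys ≡ true → xs ≡ ys
eqListℕ⇒≡ []       []       e = refl
eqListℕ⇒≡ (x ∷ xs) (y ∷ ys) e = cong₂ _∷_ (from-≡ᵇ (∧-conicalˡ (x ≡ᵇ y) _ e)) (eqListℕ⇒≡ xs ys (∧-conicalʳ (x ≡ᵇ y) _ e))

eqListℕ-refl : ∀ xs → eqListℕ xs xs ≡ true
eqListℕ-refl []       = refl
eqListℕ-refl (x ∷ xs) rewrite ≡ᵇ-refl x = eqListℕ-refl xs

head<∈ : ∀ {x xs z} → Linked _<_ (x ∷ xs) → z ∈ xs → x < z
head<∈ (x<y ∷ _)  (here refl) = x<y
head<∈ (x<y ∷ xs) (there z∈)  = <-trans x<y (head<∈ xs z∈)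

∈-tail : ∀ {x xs ys z} → Linked _<_ (x ∷ xs) → z ∈ xs → z ∈ x ∷ ys → z ∈ ys
∈-tail x∷xs z∈xs (here z≡x)   = ⊥-elim (<-irrefl (sym z≡x) (head<∈ x∷xs z∈xs))
∈-tail x∷xs z∈xs (there z∈ys) = z∈ys

increasing-≡ : ∀ {xs ys} → Linked _<_ xs → Linked _<_ ys →
  (∀ {z} → z ∈ xs → z ∈ ys) → (∀ {z} → z ∈ ys → z ∈ xs) → xs ≡ ys
increasing-≡ {[]}     {[]}     _  _  _ _ = refl
increasing-≡ {[]}     {y ∷ ys} _  _  _ g with () ← g (here refl)
increasing-≡ {x ∷ xs} {[]}     _  _  f _ with () ← f (here refl)
increasing-≡ {x ∷ xs} {y ∷ ys} lx ly f g with f (here refl) | g (here refl)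
... | here refl  | _          =
  cong (x ∷_) (increasing-≡ (Linked.tail lx) (Linked.tail ly)
                            (λ z∈ → ∈-tail lx z∈ (f (there z∈))) (λ z∈ → ∈-tail ly z∈ (g (there z∈))))
... | there x∈ys | here refl  = ⊥-elim (<-irrefl refl (head<∈ ly x∈ys))
... | there x∈ys | there y∈xs = ⊥-elim (<-asym (head<∈ lx y∈xs) (head<∈ ly x∈ys))

sameElementsᵇ≡eqListℕ : ∀ xs ys → Linked _<_ xs → Linked _<_ ys →
  (all (λ x → any (λ y → x ≡ᵇ y) ys) xs ∧ all (λ y → any (λ x → y ≡ᵇ x) xs) ys) ≡ eqListℕ xs ys
sameElementsᵇ≡eqListℕ xs ys lx ly = bool-ext
  (λ e → let (xs⊆ys , ys⊆xs) = ∧-split _ _ e in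
    subst (λ w → eqListℕ xs w ≡ true)
          (increasing-≡ lx ly (λ {z} z∈ → any-≡ᵇ⇒∈ z ys (all⇒ _ xs xs⊆ys z∈))
                              (λ {z} z∈ → any-≡ᵇ⇒∈ z xs (all⇒ _ ys ys⊆xs z∈)))
          (eqListℕ-refl xs))
  (λ e → let xs≡ys = eqListℕ⇒≡ xs ys e in
    ∧-true (⇒all _ xs (λ {z} z∈ → ∈⇒any-≡ᵇ z ys (subst (z ∈_) xs≡ys z∈)))
           (⇒all _ ys (λ {z} z∈ → ∈⇒any-≡ᵇ z xs (subst (z ∈_) (sym xs≡ys) z∈))))

rowSums-increasing : ∀ rows → consecutive columnsIncreaseᵇ rows ≡ true → Linked _<_ (map (λ r → proj₁ r + proj₂ r) rows)
rowSums-increasing []                 e = []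
rowSums-increasing (r ∷ [])           e = [-]
rowSums-increasing (r ∷ r' ∷ rows)    e =
  +-mono-< {proj₁ r} {proj₁ r'} {proj₂ r} {proj₂ r'} (from-<ᵇ (∧-conicalˡ _ _ columns)) (from-<ᵇ (∧-conicalʳ _ _ columns))
  ∷ rowSums-increasing (r' ∷ rows) (∧-conicalʳ (columnsIncreaseᵇ r r') _ e)
  where
  columns : columnsIncreaseᵇ r r' ≡ true
  columns = ∧-conicalˡ (columnsIncreaseᵇ r r') _ e

columnsIncreaseᵇ-origin : ∀ rows → all goodRowᵇ rows ≡ true →
  consecutive columnsIncreaseᵇ ((0 , 0) ∷ rows) ≡ consecutive columnsIncreaseᵇ rows
columnsIncreaseᵇ-origin []             e = refl
columnsIncreaseᵇ-origin ((u , v) ∷ rows) e with ∧-split (1 ≤ᵇ u) (u ≤ᵇ v) (∧-conicalˡ (goodRowᵇ (u , v)) _ e)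
... | 0<u , u≤v rewrite 0<u | to-<ᵇ (<-≤-trans (from-<ᵇ {0} {u} 0<u) (from-≤ᵇ u≤v)) = refl

numTableaux≡tableauCount : ∀ n k (S : Subset (2 * n ∸ 1)) → ∣ S ∣ ≡ k → numTableaux n k S ≡ tableauCount n 0 0 (elems S)
numTableaux≡tableauCount n k S refl = begin
  numTableaux n ∣ S ∣ S
    ≡⟨ count≡sumL _ (allVecsOf ∣ S ∣ (rowCandidates n)) ⟩
  sumL (allVecsOf ∣ S ∣ (rowCandidates n)) (λ T → ind (isSSYTᵇ T ∧ entriesBelowᵇ n T ∧ rowSumSetEqᵇ T S))
    ≡⟨ cong (λ k' → sumL (allVecsOf k' (rowCandidates n)) (λ T → ind (isSSYTᵇ T ∧ entriesBelowᵇ n T ∧ rowSumSetEqᵇ T S)))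
            (sym length-elems) ⟩
  sumL (allVecsOf (length (elems S)) (rowCandidates n)) (λ T → ind (isSSYTᵇ T ∧ entriesBelowᵇ n T ∧ rowSumSetEqᵇ T S))
    ≡⟨ sumL-cong (allVecsOf (length (elems S)) (rowCandidates n)) (cong ind ∘ conditions) ⟩
  sumL (allVecsOf (length (elems S)) (rowCandidates n)) (λ T → ind (tableauUnderᵇ n (0 , 0) (toList T) ∧ eqListℕ (rowSums T) (elems S)))
    ≡⟨ tableauCount-enumeration n (elems S) 0 0 ⟩
  tableauCount n 0 0 (elems S) ∎
  where
  open ≡-Reasoning
  length-elems : length (elems S) ≡ ∣ S ∣
  length-elems = trans (cong length (elems≡elemsFrom S)) (length-elemsFrom 1 S)
  elems-increasing : Linked _<_ (elems S)
  elems-increasing = subst (Linked _<_) (sym (elems≡elemsFrom S)) (Linked.tail (elemsFrom-increasing 0 1 z<s S))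
  regroup : ∀ X Y Z W V Y₀ → (X ≡ true → Y₀ ≡ Y) → (X ≡ true → Y ≡ true → W ≡ V) →
    ((X ∧ Y) ∧ (Z ∧ W)) ≡ (((X ∧ Z) ∧ Y₀) ∧ V)
  regroup false Y     Z     W V Y₀ _  _  = refl
  regroup true  false false W V Y₀ _  _  = refl
  regroup true  false true  W V Y₀ h₁ _  rewrite h₁ refl = refl
  regroup true  true  false W V Y₀ _  _  = refl
  regroup true  true  true  W V Y₀ h₁ h₂ rewrite h₁ refl = h₂ refl refl
  conditions : ∀ {k'} (T : Vec (ℕ × ℕ) k') →
    (isSSYTᵇ T ∧ entriesBelowᵇ n T ∧ rowSumSetEqᵇ T S) ≡ (tableauUnderᵇ n (0 , 0) (toList T) ∧ eqListℕ (rowSums T) (elems S))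
  conditions T = regroup (all goodRowᵇ (toList T)) (consecutive columnsIncreaseᵇ (toList T))
    (all (rowEntriesBelowᵇ n) (toList T)) (rowSumSetEqᵇ T S) (eqListℕ (rowSums T) (elems S))
    (consecutive columnsIncreaseᵇ ((0 , 0) ∷ toList T)) (columnsIncreaseᵇ-origin (toList T))
    (λ _ increasing → sameElementsᵇ≡eqListℕ (rowSums T) (elems S) (rowSums-increasing (toList T) increasing) elems-increasing)

-- Chains of ideals versus tableaux

Σ²-+ : ∀ n (f g : ℕ → ℕ → ℕ) → Σ² n (λ a b → f a b + g a b) ≡ Σ² n f + Σ² n g
Σ²-+ n f g = trans (Σ<-cong (suc n) (λ b _ → Σ<-+ (suc n) (λ a → f a b) (λ a → g a b))) (Σ<-+ (suc n) _ _)

Σ²-*ˡ : ∀ n c (f : ℕ → ℕ → ℕ) → c * Σ² n f ≡ Σ² n (λ a b → c * f a b)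
Σ²-*ˡ n c f = trans (Σ<-*ˡ c (suc n) _) (Σ<-cong (suc n) (λ b _ → Σ<-*ˡ c (suc n) _))

Σ²-*ʳ : ∀ n (f : ℕ → ℕ → ℕ) c → Σ² n (λ a b → f a b * c) ≡ Σ² n f * c
Σ²-*ʳ n f c = trans (Σ²-cong n (λ a b _ _ → *-comm (f a b) c)) (trans (sym (Σ²-*ˡ n c f)) (*-comm c _))

Σ²-swap : ∀ n m (f : ℕ → ℕ → ℕ → ℕ → ℕ) → Σ² n (λ a b → Σ² m (f a b)) ≡ Σ² m (λ a₁ b₁ → Σ² n (λ a b → f a b a₁ b₁))
Σ²-swap n m f =
  trans (Σ<-cong (suc n) (λ b _ → Σ<-swap (suc n) (suc m) (λ a b₁ → Σ< (suc m) (λ a₁ → f a b a₁ b₁))))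
  (trans (Σ<-swap (suc n) (suc m) (λ b b₁ → Σ< (suc n) (λ a → Σ< (suc m) (λ a₁ → f a b a₁ b₁))))
  (Σ<-cong (suc m) (λ b₁ _ → trans (Σ<-cong (suc n) (λ b _ → Σ<-swap (suc n) (suc m) (λ a a₁ → f a b a₁ b₁)))
                                   (Σ<-swap (suc n) (suc m) (λ b a₁ → Σ< (suc n) (λ a → f a b a₁ b₁))))))

Σ²-interchange : ∀ n (f : ℕ → ℕ → ℕ) (g : ℕ → ℕ → ℕ → ℕ → ℕ) (k : ℕ → ℕ → ℕ) →
  Σ² n (λ a b → f a b * Σ² n (λ a₁ b₁ → g a b a₁ b₁ * k a₁ b₁))
    ≡ Σ² n (λ a₁ b₁ → Σ² n (λ a b → f a b * g a b a₁ b₁) * k a₁ b₁)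
Σ²-interchange n f g k =
  trans (Σ²-cong n (λ a b _ _ → Σ²-*ˡ n (f a b) _))
  (trans (Σ²-swap n n _)
         (Σ²-cong n (λ a₁ b₁ _ _ → trans (Σ²-cong n (λ a b _ _ → sym (*-assoc (f a b) _ (k a₁ b₁))))
                                         (Σ²-*ʳ n _ (k a₁ b₁)))))

Σ<-point : ∀ m (f : ℕ → ℕ) c → c < m → (∀ z → z < m → z ≢ c → f z ≡ 0) → Σ< m f ≡ f c
Σ<-point (suc m) f c c<1+m h with m ≟ c
... | yes refl = cong (_+ f m) (Σ<-zero m f (λ z z<m → h z (m<n⇒m<1+n z<m) (λ z≡m → <-irrefl z≡m z<m)))
... | no  m≢c  =
  trans (cong₂ _+_ (Σ<-point m f c (≤∧≢⇒< (≤-pred c<1+m) (m≢c ∘ sym)) (λ z z<m → h z (m<n⇒m<1+n z<m)))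
                   (h m ≤-refl m≢c))
        (+-identityʳ _)

Σ²-unique : ∀ n (c : ℕ → ℕ → Bool) a₀ b₀ → a₀ ≤ n → b₀ ≤ n →
  (∀ a b → a ≤ n → b ≤ n → c a b ≡ true → (a ≡ a₀) × (b ≡ b₀)) → Σ² n (λ a b → ind (c a b)) ≡ ind (c a₀ b₀)
Σ²-unique n c a₀ b₀ a₀≤n b₀≤n unique =
  trans (Σ<-point (suc n) _ b₀ (s≤s b₀≤n) (λ b b< b≢b₀ →
           Σ<-zero (suc n) _ (λ a a< → vanishes a b (≤-pred a<) (≤-pred b<) (b≢b₀ ∘ proj₂))))
        (Σ<-point (suc n) _ a₀ (s≤s a₀≤n) (λ a a< a≢a₀ → vanishes a b₀ (≤-pred a<) b₀≤n (a≢a₀ ∘ proj₁)))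
  where
  vanishes : ∀ a b → a ≤ n → b ≤ n → ¬ ((a ≡ a₀) × (b ≡ b₀)) → ind (c a b) ≡ 0
  vanishes a b a≤n b≤n ne with c a b in cab
  ... | true  = ⊥-elim (ne (unique a b a≤n b≤n cab))
  ... | false = refl

Σ²-none : ∀ n (c : ℕ → ℕ → Bool) → (∀ a b → a ≤ n → b ≤ n → c a b ≡ true → ⊥) → Σ² n (λ a b → ind (c a b)) ≡ 0
Σ²-none n c none = Σ<-zero (suc n) _ (λ b b< → Σ<-zero (suc n) _ (λ a a< → vanishes a b (≤-pred a<) (≤-pred b<)))
  where
  vanishes : ∀ a b → a ≤ n → b ≤ n → ind (c a b) ≡ 0
  vanishes a b a≤n b≤n with c a b in cab
  ... | true  = ⊥-elim (none a b a≤n b≤n cab)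
  ... | false = refl

firstIdealᵇ : ℕ → ℕ → ℕ → ℕ → ℕ → Bool
firstIdealᵇ y x t a b = (b ≤ᵇ a) ∧ ((a + b ≡ᵇ t) ∧ ((suc y ≤ᵇ a) ∧ (x ≤ᵇ b)))

∧₇-split : ∀ (p₁ p₂ p₃ p₄ p₅ p₆ p₇ : Bool) → (((p₁ ∧ (p₂ ∧ (p₃ ∧ p₄))) ∧ p₅) ∧ (p₆ ∧ p₇)) ≡ true →
  (p₁ ≡ true) × (p₂ ≡ true) × (p₃ ≡ true) × (p₄ ≡ true) × (p₅ ≡ true) × (p₆ ≡ true) × (p₇ ≡ true)
∧₇-split true true true true true true true _ = refl , refl , refl , refl , refl , refl , refl

∧₇-intro : ∀ (p₁ p₂ p₃ p₄ p₅ p₆ p₇ : Bool) → p₁ ≡ true → p₂ ≡ true → p₃ ≡ true → p₄ ≡ true → p₅ ≡ true → p₆ ≡ true → p₇ ≡ true →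
  (((p₁ ∧ (p₂ ∧ (p₃ ∧ p₄))) ∧ p₅) ∧ (p₆ ∧ p₇)) ≡ true
∧₇-intro _ _ _ _ _ _ _ refl refl refl refl refl refl refl = refl

-- In a chain through (y + 1, x), then an ideal of rank t, then (a₁, b₁), the ideal of rank t
-- is determined by (a₁, b₁): it keeps the second row x if that fits under a₁, and otherwise
-- it has first row a₁.
module Predecessor (n x y t a₁ b₁ : ℕ) (a₁≤n : a₁ ≤ n) (b₁≤a₁ : b₁ ≤ a₁) (t<a₁+b₁ : t < a₁ + b₁)
                   (x+y<t : x + y < t) (x≤1+y : x ≤ suc y) (y<n : y < n) where

  keepsRow₂ : ℕ → ℕ → Bool
  keepsRow₂ a b = (firstIdealᵇ y x t a b ∧ (b ≡ᵇ x)) ∧ ((a ≤ᵇ a₁) ∧ (b ≤ᵇ b₁))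

  keepsRow₁ : ℕ → ℕ → Bool
  keepsRow₁ a b = (firstIdealᵇ y x t a b ∧ (x <ᵇ b)) ∧ ((a₁ ≡ᵇ a) ∧ (b ≤ᵇ b₁))

  above : Bool
  above = (suc y ≤ᵇ a₁) ∧ (x ≤ᵇ b₁)

  x≤n : x ≤ n
  x≤n = ≤-trans x≤1+y y<n

  count-keepsRow₂ : ∀ d → d + x ≡ t → d ≤ a₁ →
    Σ² n (λ a b → ind (keepsRow₂ a b)) + Σ² n (λ a b → ind (keepsRow₁ a b)) ≡ ind above
  count-keepsRow₂ d refl d≤a₁ =
    trans (cong₂ _+_ (Σ²-unique n keepsRow₂ d x (≤-trans d≤a₁ a₁≤n) x≤n unique) (Σ²-none n keepsRow₁ none))
          (trans (+-identityʳ _) (cong ind (bool-ext sound complete)))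
    where
    y<d : y < d
    y<d = +-cancelˡ-< x y d (subst (x + y <_) (+-comm d x) x+y<t)
    unique : ∀ a b → a ≤ n → b ≤ n → keepsRow₂ a b ≡ true → (a ≡ d) × (b ≡ x)
    unique a b _ _ e with ∧₇-split (b ≤ᵇ a) (a + b ≡ᵇ t) (suc y ≤ᵇ a) (x ≤ᵇ b) (b ≡ᵇ x) (a ≤ᵇ a₁) (b ≤ᵇ b₁) e
    ... | _ , a+b≡t , _ , _ , b≡x , _ , _ =
      +-cancelʳ-≡ x a d (subst (λ z → a + z ≡ d + x) (from-≡ᵇ b≡x) (from-≡ᵇ a+b≡t)) , from-≡ᵇ b≡x
    none : ∀ a b → a ≤ n → b ≤ n → keepsRow₁ a b ≡ true → ⊥
    none a b _ _ e with ∧₇-split (b ≤ᵇ a) (a + b ≡ᵇ t) (suc y ≤ᵇ a) (x ≤ᵇ b) (x <ᵇ b) (a₁ ≡ᵇ a) (b ≤ᵇ b₁) e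
    ... | _ , a+b≡t , _ , _ , x<b , a₁≡a , _ =
      <-irrefl refl (<-≤-trans (+-monoʳ-< a₁ (from-<ᵇ x<b))
        (subst (λ z → z + b ≤ a₁ + x) (sym (from-≡ᵇ a₁≡a)) (subst (_≤ a₁ + x) (sym (from-≡ᵇ a+b≡t)) (+-monoˡ-≤ x d≤a₁))))
    sound : keepsRow₂ d x ≡ true → above ≡ true
    sound e with ∧₇-split (x ≤ᵇ d) (d + x ≡ᵇ t) (suc y ≤ᵇ d) (x ≤ᵇ x) (x ≡ᵇ x) (d ≤ᵇ a₁) (x ≤ᵇ b₁) e
    ... | _ , _ , y<d' , _ , _ , d≤a₁' , x≤b₁ =
      ∧-true (to-≤ᵇ {suc y} {a₁} (≤-trans (from-≤ᵇ {suc y} {d} y<d') (from-≤ᵇ {d} {a₁} d≤a₁'))) x≤b₁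
    complete : above ≡ true → keepsRow₂ d x ≡ true
    complete e = ∧₇-intro (x ≤ᵇ d) (d + x ≡ᵇ t) (suc y ≤ᵇ d) (x ≤ᵇ x) (x ≡ᵇ x) (d ≤ᵇ a₁) (x ≤ᵇ b₁)
                          (to-≤ᵇ (≤-trans x≤1+y y<d)) (≡ᵇ-refl (d + x)) (to-≤ᵇ y<d) (to-≤ᵇ {x} {x} ≤-refl)
                          (≡ᵇ-refl x) (to-≤ᵇ d≤a₁) (∧-conicalʳ (suc y ≤ᵇ a₁) _ e)

  count-keepsRow₁ : ∀ e → a₁ + e ≡ t → x < e →
    Σ² n (λ a b → ind (keepsRow₂ a b)) + Σ² n (λ a b → ind (keepsRow₁ a b)) ≡ ind above
  count-keepsRow₁ e refl x<e =
    trans (cong₂ _+_ (Σ²-none n keepsRow₂ none) (Σ²-unique n keepsRow₁ a₁ e a₁≤n (≤-trans e≤a₁ a₁≤n) unique))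
          (cong ind (bool-ext sound complete))
    where
    e<b₁ : e < b₁
    e<b₁ = +-cancelˡ-< a₁ e b₁ t<a₁+b₁
    e≤a₁ : e ≤ a₁
    e≤a₁ = ≤-trans (<⇒≤ e<b₁) b₁≤a₁
    unique : ∀ a b → a ≤ n → b ≤ n → keepsRow₁ a b ≡ true → (a ≡ a₁) × (b ≡ e)
    unique a b _ _ h with ∧₇-split (b ≤ᵇ a) (a + b ≡ᵇ t) (suc y ≤ᵇ a) (x ≤ᵇ b) (x <ᵇ b) (a₁ ≡ᵇ a) (b ≤ᵇ b₁) h
    ... | _ , a+b≡t , _ , _ , _ , a₁≡a , _ =
      sym (from-≡ᵇ a₁≡a) , +-cancelˡ-≡ a₁ b e (subst (λ z → z + b ≡ a₁ + e) (sym (from-≡ᵇ a₁≡a)) (from-≡ᵇ a+b≡t))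
    none : ∀ a b → a ≤ n → b ≤ n → keepsRow₂ a b ≡ true → ⊥
    none a b _ _ h with ∧₇-split (b ≤ᵇ a) (a + b ≡ᵇ t) (suc y ≤ᵇ a) (x ≤ᵇ b) (b ≡ᵇ x) (a ≤ᵇ a₁) (b ≤ᵇ b₁) h
    ... | _ , a+b≡t , _ , _ , b≡x , a≤a₁ , _ =
      <-irrefl refl (≤-<-trans
        (subst (_≤ a₁ + x) (from-≡ᵇ a+b≡t) (subst (λ z → a + z ≤ a₁ + x) (sym (from-≡ᵇ b≡x)) (+-monoˡ-≤ x (from-≤ᵇ a≤a₁))))
        (+-monoʳ-< a₁ x<e))
    sound : keepsRow₁ a₁ e ≡ true → above ≡ true
    sound h with ∧₇-split (e ≤ᵇ a₁) (a₁ + e ≡ᵇ t) (suc y ≤ᵇ a₁) (x ≤ᵇ e) (x <ᵇ e) (a₁ ≡ᵇ a₁) (e ≤ᵇ b₁) h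
    ... | _ , _ , y<a₁ , _ , _ , _ , e≤b₁ = ∧-true y<a₁ (to-≤ᵇ (≤-trans (<⇒≤ x<e) (from-≤ᵇ e≤b₁)))
    complete : above ≡ true → keepsRow₁ a₁ e ≡ true
    complete h = ∧₇-intro (e ≤ᵇ a₁) (a₁ + e ≡ᵇ t) (suc y ≤ᵇ a₁) (x ≤ᵇ e) (x <ᵇ e) (a₁ ≡ᵇ a₁) (e ≤ᵇ b₁)
                          (to-≤ᵇ e≤a₁) (≡ᵇ-refl (a₁ + e)) (∧-conicalˡ (suc y ≤ᵇ a₁) _ h) (to-≤ᵇ (<⇒≤ x<e))
                          (to-<ᵇ x<e) (≡ᵇ-refl a₁) (to-≤ᵇ (<⇒≤ e<b₁))

  predecessors : Σ² n (λ a b → ind (keepsRow₂ a b)) + Σ² n (λ a b → ind (keepsRow₁ a b)) ≡ ind above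
  predecessors with ≤-<-connex t (a₁ + x)
  ... | inj₁ t≤a₁+x =
    count-keepsRow₂ (t ∸ x) (m∸n+n≡m x≤t) (+-cancelʳ-≤ x (t ∸ x) a₁ (subst (_≤ a₁ + x) (sym (m∸n+n≡m x≤t)) t≤a₁+x))
    where
    x≤t : x ≤ t
    x≤t = ≤-trans (m≤m+n x y) (<⇒≤ x+y<t)
  ... | inj₂ a₁+x<t =
    count-keepsRow₁ (t ∸ a₁) (m+[n∸m]≡n a₁≤t) (+-cancelˡ-< a₁ x (t ∸ a₁) (subst (a₁ + x <_) (sym (m+[n∸m]≡n a₁≤t)) a₁+x<t))
    where
    a₁≤t : a₁ ≤ t
    a₁≤t = ≤-trans (m≤m+n a₁ x) (<⇒≤ a₁+x<t)

-- stalledCount n a b ts counts the chains above (a, b) whose first ideal has first row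
-- exactly a; the empty chain is counted when a = n, i.e. as if chains ended at the top (n, n).
stalledCount : ℕ → ℕ → ℕ → List ℕ → ℕ
stalledCount n a b []        = ind (a ≡ᵇ n)
stalledCount n a b (t₁ ∷ ts) =
  Σ² n (λ a₁ b₁ → ind (b₁ ≤ᵇ a₁) * (ind ((a₁ + b₁ ≡ᵇ t₁) ∧ ((a₁ ≡ᵇ a) ∧ (b ≤ᵇ b₁))) * chainCount n a₁ b₁ ts))

<ᵇ-irrefl : ∀ n → (n <ᵇ n) ≡ false
<ᵇ-irrefl n = not-true⇒false (λ n<n → <-irrefl refl (from-<ᵇ {n} {n} n<n))

ind-≤ᵇ-split : ∀ n a a₁ → a ≤ n → a₁ ≤ n → ind (a ≤ᵇ a₁) ≡ ind (a <ᵇ n) * ind (suc a ≤ᵇ a₁) + ind (a₁ ≡ᵇ a)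
ind-≤ᵇ-split n a a₁ a≤n a₁≤n with <-cmp a a₁
... | tri< a<a₁ _ _
  rewrite to-≤ᵇ {a} {a₁} (<⇒≤ a<a₁) | to-<ᵇ {a} {n} (<-≤-trans a<a₁ a₁≤n) | to-≤ᵇ {suc a} {a₁} a<a₁
        | not-true⇒false {a₁ ≡ᵇ a} (λ e → <-irrefl (sym (from-≡ᵇ e)) a<a₁) = refl
... | tri≈ _ refl _
  rewrite to-≤ᵇ {a} {a} ≤-refl | <ᵇ-irrefl a | ≡ᵇ-refl a = cong (_+ 1) (sym (*-zeroʳ (ind (a <ᵇ n))))
... | tri> _ _ a₁<a
  rewrite not-true⇒false {a ≤ᵇ a₁} (λ e → <⇒≱ a₁<a (from-≤ᵇ e))
        | not-true⇒false {suc a ≤ᵇ a₁} (λ e → <⇒≱ a₁<a (≤-trans (n≤1+n a) (from-≤ᵇ e)))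
        | not-true⇒false {a₁ ≡ᵇ a} (λ e → <-irrefl (from-≡ᵇ e) a₁<a) =
  sym (trans (+-identityʳ _) (*-zeroʳ (ind (a <ᵇ n))))

chainCount-split : ∀ n a b ts → a ≤ n → chainCount n a b ts ≡ ind (a <ᵇ n) * chainCount n (suc a) b ts + stalledCount n a b ts
chainCount-split n a b [] a≤n with m≤n⇒m<n∨m≡n a≤n
... | inj₁ a<n  rewrite to-<ᵇ a<n | not-true⇒false {a ≡ᵇ n} (λ e → <-irrefl (from-≡ᵇ e) a<n) = refl
... | inj₂ refl rewrite <ᵇ-irrefl a | ≡ᵇ-refl a = refl
chainCount-split n a b (t₁ ∷ ts) a≤n =
  sym (trans (cong (_+ stalledCount n a b (t₁ ∷ ts)) (Σ²-*ˡ n (ind (a <ᵇ n)) _))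
      (trans (sym (Σ²-+ n _ _)) (Σ²-cong n (λ a₁ b₁ a₁≤n _ → sym (by-first-row a₁ b₁ a₁≤n)))))
  where
  distribute : ∀ i e j p q c C → i * (e * ((j * p + q) * c) * C) ≡ j * (i * (e * (p * c) * C)) + i * (e * (q * c) * C)
  distribute = ℕ-Ring.solve-∀
  ind-∧-∧ʳ : ∀ e p c → ind (e ∧ (p ∧ c)) ≡ ind e * (ind p * ind c)
  ind-∧-∧ʳ e p c = trans (ind-∧ e (p ∧ c)) (cong (ind e *_) (ind-∧ p c))
  by-first-row : ∀ a₁ b₁ → a₁ ≤ n →
    ind (b₁ ≤ᵇ a₁) * (ind ((a₁ + b₁ ≡ᵇ t₁) ∧ ((a ≤ᵇ a₁) ∧ (b ≤ᵇ b₁))) * chainCount n a₁ b₁ ts) ≡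
    ind (a <ᵇ n) * (ind (b₁ ≤ᵇ a₁) * (ind ((a₁ + b₁ ≡ᵇ t₁) ∧ ((suc a ≤ᵇ a₁) ∧ (b ≤ᵇ b₁))) * chainCount n a₁ b₁ ts))
    + ind (b₁ ≤ᵇ a₁) * (ind ((a₁ + b₁ ≡ᵇ t₁) ∧ ((a₁ ≡ᵇ a) ∧ (b ≤ᵇ b₁))) * chainCount n a₁ b₁ ts)
  by-first-row a₁ b₁ a₁≤n
    rewrite ind-∧-∧ʳ (a₁ + b₁ ≡ᵇ t₁) (a ≤ᵇ a₁) (b ≤ᵇ b₁) | ind-∧-∧ʳ (a₁ + b₁ ≡ᵇ t₁) (suc a ≤ᵇ a₁) (b ≤ᵇ b₁)
          | ind-∧-∧ʳ (a₁ + b₁ ≡ᵇ t₁) (a₁ ≡ᵇ a) (b ≤ᵇ b₁) | ind-≤ᵇ-split n a a₁ a≤n a₁≤n =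
    distribute (ind (b₁ ≤ᵇ a₁)) (ind (a₁ + b₁ ≡ᵇ t₁)) (ind (a <ᵇ n)) (ind (suc a ≤ᵇ a₁)) (ind (a₁ ≡ᵇ a))
               (ind (b ≤ᵇ b₁)) (chainCount n a₁ b₁ ts)

firstIdealᵇ⇒ : ∀ y x t a b → firstIdealᵇ y x t a b ≡ true → (b ≤ a) × (a + b ≡ t) × (y < a) × (x ≤ b)
firstIdealᵇ⇒ y x t a b e with ∧-split (b ≤ᵇ a) _ e
... | b≤a , e₂ with ∧-split (a + b ≡ᵇ t) _ e₂
... | a+b≡t , e₃ with ∧-split (suc y ≤ᵇ a) (x ≤ᵇ b) e₃
... | y<a , x≤b = from-≤ᵇ {b} {a} b≤a , from-≡ᵇ a+b≡t , from-≤ᵇ {suc y} {a} y<a , from-≤ᵇ {x} {b} x≤b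

firstIdealᵇ⇐ : ∀ y x t a b → b ≤ a → a + b ≡ t → y < a → x ≤ b → firstIdealᵇ y x t a b ≡ true
firstIdealᵇ⇐ y x t a b b≤a refl y<a x≤b rewrite to-≤ᵇ b≤a | to-≤ᵇ y<a | to-≤ᵇ x≤b | ≡ᵇ-refl (a + b) = refl

ind-firstIdealᵇ : ∀ y x t a b →
  ind (firstIdealᵇ y x t a b) ≡ ind (firstIdealᵇ y x t a b ∧ (b ≡ᵇ x)) + ind (firstIdealᵇ y x t a b ∧ (x <ᵇ b))
ind-firstIdealᵇ y x t a b with firstIdealᵇ y x t a b in first
... | false = refl
... | true with m≤n⇒m<n∨m≡n (proj₂ (proj₂ (proj₂ (firstIdealᵇ⇒ y x t a b first))))
...   | inj₁ x<b  rewrite to-<ᵇ x<b | not-true⇒false {b ≡ᵇ x} (λ e → <-irrefl (sym (from-≡ᵇ e)) x<b) = refl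
...   | inj₂ refl rewrite ≡ᵇ-refl x | <ᵇ-irrefl x = refl

firstIdealᵇ≡rowAbove : ∀ n x y t a b → ((firstIdealᵇ y x t a b ∧ (x <ᵇ b)) ∧ (a <ᵇ n)) ≡ ((b + a ≡ᵇ t) ∧ rowAbove n x y b a)
firstIdealᵇ≡rowAbove n x y t a b = bool-ext sound complete
  where
  sound : ((firstIdealᵇ y x t a b ∧ (x <ᵇ b)) ∧ (a <ᵇ n)) ≡ true → ((b + a ≡ᵇ t) ∧ rowAbove n x y b a) ≡ true
  sound e with ∧-split (firstIdealᵇ y x t a b ∧ (x <ᵇ b)) (a <ᵇ n) e
  ... | e₁ , a<n with ∧-split (firstIdealᵇ y x t a b) (x <ᵇ b) e₁
  ... | first , x<b with firstIdealᵇ⇒ y x t a b first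
  ... | b≤a , a+b≡t , y<a , _
    rewrite +-comm b a | a+b≡t | ≡ᵇ-refl t | to-≤ᵇ {1} {b} (≤-<-trans z≤n (from-<ᵇ {x} {b} x<b)) | to-≤ᵇ b≤a
          | to-<ᵇ {b} {n} (≤-<-trans b≤a (from-<ᵇ {a} {n} a<n)) | a<n | x<b | to-<ᵇ y<a = refl
  complete : ((b + a ≡ᵇ t) ∧ rowAbove n x y b a) ≡ true → ((firstIdealᵇ y x t a b ∧ (x <ᵇ b)) ∧ (a <ᵇ n)) ≡ true
  complete e with ∧-split (b + a ≡ᵇ t) (rowAbove n x y b a) e
  ... | b+a≡t , row with ∧-split (((1 ≤ᵇ b) ∧ (b ≤ᵇ a)) ∧ ((b <ᵇ n) ∧ (a <ᵇ n))) ((x <ᵇ b) ∧ (y <ᵇ a)) row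
  ... | r₁ , r₂ with ∧-split ((1 ≤ᵇ b) ∧ (b ≤ᵇ a)) ((b <ᵇ n) ∧ (a <ᵇ n)) r₁ | ∧-split (x <ᵇ b) (y <ᵇ a) r₂
  ... | r₁₁ , r₁₂ | x<b , y<a with ∧-split (1 ≤ᵇ b) (b ≤ᵇ a) r₁₁ | ∧-split (b <ᵇ n) (a <ᵇ n) r₁₂
  ... | _ , b≤a | _ , a<n
    rewrite firstIdealᵇ⇐ y x t a b (from-≤ᵇ {b} {a} b≤a) (trans (+-comm a b) (from-≡ᵇ b+a≡t)) (from-<ᵇ {y} {a} y<a)
                         (<⇒≤ (from-<ᵇ {x} {b} x<b)) | x<b | a<n = refl

-- Expanding the first ideal (a, b) of a chain above (y + 1, x): either the first row grows
-- afterwards and x < b, which makes (b, a) a tableau row, or not.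
first-ideal-split : ∀ n x y t a b ts → a ≤ n →
  ind (b ≤ᵇ a) * (ind ((a + b ≡ᵇ t) ∧ ((suc y ≤ᵇ a) ∧ (x ≤ᵇ b))) * chainCount n a b ts) ≡
  ind ((b + a ≡ᵇ t) ∧ rowAbove n x y b a) * chainCount n (suc a) b ts
  + (ind (firstIdealᵇ y x t a b ∧ (b ≡ᵇ x)) * chainCount n a b ts + ind (firstIdealᵇ y x t a b ∧ (x <ᵇ b)) * stalledCount n a b ts)
first-ideal-split n x y t a b ts a≤n = begin
  ind (b ≤ᵇ a) * (ind ((a + b ≡ᵇ t) ∧ ((suc y ≤ᵇ a) ∧ (x ≤ᵇ b))) * C)
    ≡⟨ *-assoc (ind (b ≤ᵇ a)) _ C ⟨
  ind (b ≤ᵇ a) * ind ((a + b ≡ᵇ t) ∧ ((suc y ≤ᵇ a) ∧ (x ≤ᵇ b))) * C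
    ≡⟨ cong (_* C) (ind-∧ (b ≤ᵇ a) _) ⟨
  ind (firstIdealᵇ y x t a b) * C
    ≡⟨ cong (_* C) (ind-firstIdealᵇ y x t a b) ⟩
  (i₂ + i₁) * C
    ≡⟨ *-distribʳ-+ C i₂ i₁ ⟩
  i₂ * C + i₁ * C
    ≡⟨ cong (λ z → i₂ * C + i₁ * z) (chainCount-split n a b ts a≤n) ⟩
  i₂ * C + i₁ * (j * C⁺ + V)
    ≡⟨ regroup i₂ i₁ j C C⁺ V ⟩
  i₁ * j * C⁺ + (i₂ * C + i₁ * V)
    ≡⟨ cong (λ z → z * C⁺ + (i₂ * C + i₁ * V))
            (trans (sym (ind-∧ (firstIdealᵇ y x t a b ∧ (x <ᵇ b)) (a <ᵇ n))) (cong ind (firstIdealᵇ≡rowAbove n x y t a b))) ⟩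
  ind ((b + a ≡ᵇ t) ∧ rowAbove n x y b a) * C⁺ + (i₂ * C + i₁ * V) ∎
  where
  open ≡-Reasoning
  C C⁺ V i₂ i₁ j : ℕ
  C = chainCount n a b ts
  C⁺ = chainCount n (suc a) b ts
  V = stalledCount n a b ts
  i₂ = ind (firstIdealᵇ y x t a b ∧ (b ≡ᵇ x))
  i₁ = ind (firstIdealᵇ y x t a b ∧ (x <ᵇ b))
  j = ind (a <ᵇ n)
  regroup : ∀ i₂ i₁ j C C⁺ V → i₂ * C + i₁ * (j * C⁺ + V) ≡ i₁ * j * C⁺ + (i₂ * C + i₁ * V)
  regroup = ℕ-Ring.solve-∀

≡ᵇ-sym : ∀ m k → (m ≡ᵇ k) ≡ (k ≡ᵇ m)
≡ᵇ-sym zero    zero    = refl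
≡ᵇ-sym zero    (suc k) = refl
≡ᵇ-sym (suc m) zero    = refl
≡ᵇ-sym (suc m) (suc k) = ≡ᵇ-sym m k

nextWeight : ℕ → ℕ → List ℕ → ℕ → ℕ → ℕ
nextWeight n t₁ ts a₁ b₁ = ind (b₁ ≤ᵇ a₁) * (ind (a₁ + b₁ ≡ᵇ t₁) * chainCount n a₁ b₁ ts)

ind-∧-rotate : ∀ B E P C → ind B * (ind (E ∧ P) * C) ≡ ind P * (ind B * (ind E * C))
ind-∧-rotate B E P C = trans (cong (λ z → ind B * (z * C)) (ind-∧ E P)) (rotate (ind B) (ind E) (ind P) C)
  where
  rotate : ∀ b e p c → b * (e * p * c) ≡ p * (b * (e * c))
  rotate = ℕ-Ring.solve-∀

chainCount-∷ : ∀ n a b t₁ ts →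
  chainCount n a b (t₁ ∷ ts) ≡ Σ² n (λ a₁ b₁ → ind ((a ≤ᵇ a₁) ∧ (b ≤ᵇ b₁)) * nextWeight n t₁ ts a₁ b₁)
chainCount-∷ n a b t₁ ts = Σ²-cong n (λ a₁ b₁ _ _ → ind-∧-rotate (b₁ ≤ᵇ a₁) (a₁ + b₁ ≡ᵇ t₁) _ _)

stalledCount-∷ : ∀ n a b t₁ ts →
  stalledCount n a b (t₁ ∷ ts) ≡ Σ² n (λ a₁ b₁ → ind ((a₁ ≡ᵇ a) ∧ (b ≤ᵇ b₁)) * nextWeight n t₁ ts a₁ b₁)
stalledCount-∷ n a b t₁ ts = Σ²-cong n (λ a₁ b₁ _ _ → ind-∧-rotate (b₁ ≤ᵇ a₁) (a₁ + b₁ ≡ᵇ t₁) _ _)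

*-cong-unless-zero : ∀ p q (A B C : ℕ) → (p ≡ true → q ≡ true → A ≡ B) → A * (ind p * (ind q * C)) ≡ B * (ind p * (ind q * C))
*-cong-unless-zero false q     A B C _ = trans (*-zeroʳ A) (sym (*-zeroʳ B))
*-cong-unless-zero true  false A B C _ = trans (*-zeroʳ A) (sym (*-zeroʳ B))
*-cong-unless-zero true  true  A B C h = cong (_* _) (h refl refl)

-- Dropping the first ideal is a bijection from the chains that do not start with a
-- tableau row onto the chains of the remaining ranks (see Predecessor).
stalled-sum : ∀ n x y t ts → x + y < t → x ≤ suc y → y < n → t < n + n → Linked _<_ (t ∷ ts) →
  Σ² n (λ a b → ind (firstIdealᵇ y x t a b ∧ (b ≡ᵇ x)) * chainCount n a b ts
              + ind (firstIdealᵇ y x t a b ∧ (x <ᵇ b)) * stalledCount n a b ts)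
    ≡ chainCount n (suc y) x ts
stalled-sum n x y t [] x+y<t x≤1+y y<n t<n+n _ =
  trans (Σ²-cong n pointwise) (trans (Σ²-+ n _ _) (trans predecessors top))
  where
  open Predecessor n x y t n n ≤-refl ≤-refl t<n+n x+y<t x≤1+y y<n
  pointwise : ∀ a b → a ≤ n → b ≤ n →
    ind (firstIdealᵇ y x t a b ∧ (b ≡ᵇ x)) * 1 + ind (firstIdealᵇ y x t a b ∧ (x <ᵇ b)) * ind (a ≡ᵇ n)
      ≡ ind (keepsRow₂ a b) + ind (keepsRow₁ a b)
  pointwise a b a≤n b≤n
    rewrite to-≤ᵇ a≤n | to-≤ᵇ b≤n | ≡ᵇ-sym n a | ∧-identityʳ (firstIdealᵇ y x t a b ∧ (b ≡ᵇ x)) | ∧-identityʳ (a ≡ᵇ n) =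
    cong₂ _+_ (*-identityʳ _) (sym (ind-∧ (firstIdealᵇ y x t a b ∧ (x <ᵇ b)) (a ≡ᵇ n)))
  top : ind above ≡ 1
  top rewrite to-≤ᵇ y<n | to-≤ᵇ x≤n = refl
stalled-sum n x y t (t₁ ∷ ts) x+y<t x≤1+y y<n _ (t<t₁ ∷ _) = begin
  Σ² n (λ a b → i₂ a b * chainCount n a b (t₁ ∷ ts) + i₁ a b * stalledCount n a b (t₁ ∷ ts))
    ≡⟨ Σ²-cong n (λ a b _ _ → cong₂ _+_ (cong (i₂ a b *_) (chainCount-∷ n a b t₁ ts))
                                         (cong (i₁ a b *_) (stalledCount-∷ n a b t₁ ts))) ⟩
  Σ² n (λ a b → i₂ a b * after₂ a b + i₁ a b * after₁ a b)
    ≡⟨ Σ²-+ n _ _ ⟩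
  Σ² n (λ a b → i₂ a b * after₂ a b) + Σ² n (λ a b → i₁ a b * after₁ a b)
    ≡⟨ cong₂ _+_ (Σ²-interchange n i₂ P₂ K) (Σ²-interchange n i₁ P₁ K) ⟩
  Σ² n (λ a₁ b₁ → before₂ a₁ b₁ * K a₁ b₁) + Σ² n (λ a₁ b₁ → before₁ a₁ b₁ * K a₁ b₁)
    ≡⟨ Σ²-+ n _ _ ⟨
  Σ² n (λ a₁ b₁ → before₂ a₁ b₁ * K a₁ b₁ + before₁ a₁ b₁ * K a₁ b₁)
    ≡⟨ Σ²-cong n (λ a₁ b₁ a₁≤n _ → unique-predecessor a₁ b₁ a₁≤n) ⟩
  Σ² n (λ a₁ b₁ → ind ((suc y ≤ᵇ a₁) ∧ (x ≤ᵇ b₁)) * K a₁ b₁)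
    ≡⟨ chainCount-∷ n (suc y) x t₁ ts ⟨
  chainCount n (suc y) x (t₁ ∷ ts) ∎
  where
  open ≡-Reasoning
  i₂ i₁ : ℕ → ℕ → ℕ
  i₂ a b = ind (firstIdealᵇ y x t a b ∧ (b ≡ᵇ x))
  i₁ a b = ind (firstIdealᵇ y x t a b ∧ (x <ᵇ b))
  P₂ P₁ : ℕ → ℕ → ℕ → ℕ → ℕ
  P₂ a b a₁ b₁ = ind ((a ≤ᵇ a₁) ∧ (b ≤ᵇ b₁))
  P₁ a b a₁ b₁ = ind ((a₁ ≡ᵇ a) ∧ (b ≤ᵇ b₁))
  K : ℕ → ℕ → ℕ
  K = nextWeight n t₁ ts
  after₂ after₁ before₂ before₁ : ℕ → ℕ → ℕ
  after₂ a b = Σ² n (λ a₁ b₁ → P₂ a b a₁ b₁ * K a₁ b₁)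
  after₁ a b = Σ² n (λ a₁ b₁ → P₁ a b a₁ b₁ * K a₁ b₁)
  before₂ a₁ b₁ = Σ² n (λ a b → i₂ a b * P₂ a b a₁ b₁)
  before₁ a₁ b₁ = Σ² n (λ a b → i₁ a b * P₁ a b a₁ b₁)
  unique-predecessor : ∀ a₁ b₁ → a₁ ≤ n →
    before₂ a₁ b₁ * K a₁ b₁ + before₁ a₁ b₁ * K a₁ b₁ ≡ ind ((suc y ≤ᵇ a₁) ∧ (x ≤ᵇ b₁)) * K a₁ b₁
  unique-predecessor a₁ b₁ a₁≤n =
    trans (sym (*-distribʳ-+ (K a₁ b₁) (before₂ a₁ b₁) (before₁ a₁ b₁)))
          (*-cong-unless-zero (b₁ ≤ᵇ a₁) (a₁ + b₁ ≡ᵇ t₁) _ (ind ((suc y ≤ᵇ a₁) ∧ (x ≤ᵇ b₁))) (chainCount n a₁ b₁ ts)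
            λ b₁≤a₁ a₁+b₁≡t₁ →
             trans (cong₂ _+_ (Σ²-cong n (λ a b _ _ → sym (ind-∧ (firstIdealᵇ y x t a b ∧ (b ≡ᵇ x)) _)))
                              (Σ²-cong n (λ a b _ _ → sym (ind-∧ (firstIdealᵇ y x t a b ∧ (x <ᵇ b)) _))))
                   (Predecessor.predecessors n x y t a₁ b₁ a₁≤n (from-≤ᵇ {b₁} {a₁} b₁≤a₁)
                      (subst (t <_) (sym (from-≡ᵇ a₁+b₁≡t₁)) t<t₁) x+y<t x≤1+y y<n))

rowAbove-n₁ : ∀ n x y v → rowAbove n x y n v ≡ false
rowAbove-n₁ n x y v rewrite <ᵇ-irrefl n | ∧-zeroʳ ((1 ≤ᵇ n) ∧ (n ≤ᵇ v)) = refl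

rowAbove-n₂ : ∀ n x y u → rowAbove n x y u n ≡ false
rowAbove-n₂ n x y u rewrite <ᵇ-irrefl n | ∧-zeroʳ (u <ᵇ n) | ∧-zeroʳ ((1 ≤ᵇ u) ∧ (u ≤ᵇ n)) = refl

Σ<²≡Σ² : ∀ n (h : ℕ → ℕ → ℕ) → (∀ v → h n v ≡ 0) → (∀ u → h u n ≡ 0) →
  Σ< n (λ u → Σ< n (λ v → h u v)) ≡ Σ² n (λ a b → h b a)
Σ<²≡Σ² n h h-n₁ h-n₂ =
  sym (trans (cong₂ _+_ (Σ<-cong n (λ u _ → trans (cong (Σ< n (h u) +_) (h-n₂ u)) (+-identityʳ _)))
                        (Σ<-zero (suc n) (h n) (λ v _ → h-n₁ v)))
             (+-identityʳ _))

rowAbove⇒ : ∀ n x y u v → rowAbove n x y u v ≡ true → (u ≤ v) × (v < n)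
rowAbove⇒ n x y u v e with ∧-split (((1 ≤ᵇ u) ∧ (u ≤ᵇ v)) ∧ ((u <ᵇ n) ∧ (v <ᵇ n))) _ e
... | r , _ with ∧-split ((1 ≤ᵇ u) ∧ (u ≤ᵇ v)) ((u <ᵇ n) ∧ (v <ᵇ n)) r
... | r₁ , r₂ = from-≤ᵇ {u} {v} (∧-conicalʳ (1 ≤ᵇ u) _ r₁) , from-<ᵇ {v} {n} (∧-conicalʳ (u <ᵇ n) _ r₂)

lower-head : ∀ {lo t ts} → lo < t → Linked _<_ (t ∷ ts) → Linked _<_ (lo ∷ ts)
lower-head lo<t [-]          = [-]
lower-head lo<t (t<t₁ ∷ ts↗) = <-trans lo<t t<t₁ ∷ ts↗

chainCount≡subTableauCount : ∀ n ts x y → x ≤ suc y → y < n → Linked _<_ (x + y ∷ ts) →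
  (∀ {z} → z ∈ ts → z < n + n) → chainCount n (suc y) x ts ≡ subTableauCount n x y ts
chainCount≡subTableauCount n []       x y _ _ _ _ = refl
chainCount≡subTableauCount n (t ∷ ts) x y x≤1+y y<n (x+y<t ∷ t∷ts↗) bounded = begin
  chainCount n (suc y) x (t ∷ ts)
    ≡⟨ Σ²-cong n (λ a b a≤n _ → first-ideal-split n x y t a b ts a≤n) ⟩
  Σ² n (λ a b → row a b * chainCount n (suc a) b ts + stalled a b)
    ≡⟨ Σ²-+ n _ stalled ⟩
  Σ² n (λ a b → row a b * chainCount n (suc a) b ts) + Σ² n stalled
    ≡⟨ cong₂ _+_ (Σ²-cong n (λ a b _ _ → by-row a b)) (stalled-sum n x y t ts x+y<t x≤1+y y<n (bounded (here refl)) t∷ts↗) ⟩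
  Σ² n (λ a b → row a b * subTableauCount n b a ts) + chainCount n (suc y) x ts
    ≡⟨ cong (Σ² n (λ a b → row a b * subTableauCount n b a ts) +_)
            (chainCount≡subTableauCount n ts x y x≤1+y y<n (lower-head x+y<t t∷ts↗) (bounded ∘ there)) ⟩
  Σ² n (λ a b → row a b * subTableauCount n b a ts) + subTableauCount n x y ts
    ≡⟨ +-comm _ (subTableauCount n x y ts) ⟩
  subTableauCount n x y ts + Σ² n (λ a b → row a b * subTableauCount n b a ts)
    ≡⟨ cong (subTableauCount n x y ts +_) (Σ<²≡Σ² n (λ u v → row v u * subTableauCount n u v ts) vanish₁ vanish₂) ⟨
  subTableauCount n x y (t ∷ ts) ∎
  where
  open ≡-Reasoning
  row : ℕ → ℕ → ℕ
  row a b = ind ((b + a ≡ᵇ t) ∧ rowAbove n x y b a)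
  stalled : ℕ → ℕ → ℕ
  stalled a b = ind (firstIdealᵇ y x t a b ∧ (b ≡ᵇ x)) * chainCount n a b ts
              + ind (firstIdealᵇ y x t a b ∧ (x <ᵇ b)) * stalledCount n a b ts
  by-row : ∀ a b → row a b * chainCount n (suc a) b ts ≡ row a b * subTableauCount n b a ts
  by-row a b with (b + a ≡ᵇ t) ∧ rowAbove n x y b a in is-row
  ... | false = refl
  ... | true with ∧-split (b + a ≡ᵇ t) (rowAbove n x y b a) is-row
  ... | b+a≡t , above with rowAbove⇒ n x y b a above
  ... | b≤a , a<n = cong (1 *_) (chainCount≡subTableauCount n ts b a (m≤n⇒m≤1+n b≤a) a<n
                                   (subst (λ z → Linked _<_ (z ∷ ts)) (sym (from-≡ᵇ b+a≡t)) t∷ts↗) (bounded ∘ there))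
  vanish₁ : ∀ v → row v n * subTableauCount n n v ts ≡ 0
  vanish₁ v rewrite rowAbove-n₁ n x y v | ∧-zeroʳ (n + v ≡ᵇ t) = refl
  vanish₂ : ∀ u → row n u * subTableauCount n u n ts ≡ 0
  vanish₂ u rewrite rowAbove-n₂ n x y u | ∧-zeroʳ (u + n ≡ᵇ t) = refl

-- Every nonempty ideal contains (1, 0), so when all ranks are positive nothing changes by
-- starting the chains there instead of at the empty ideal.
chainCount-from-empty : ∀ n ts → Linked _<_ (0 ∷ ts) → chainCount n 0 0 ts ≡ chainCount n 1 0 ts
chainCount-from-empty n []       _           = refl
chainCount-from-empty n (t ∷ ts) (0<t ∷ _)   = Σ²-cong n nonempty
  where
  nonempty : ∀ a b → a ≤ n → b ≤ n →
    ind (b ≤ᵇ a) * (ind ((a + b ≡ᵇ t) ∧ ((0 ≤ᵇ a) ∧ (0 ≤ᵇ b))) * chainCount n a b ts)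
      ≡ ind (b ≤ᵇ a) * (ind ((a + b ≡ᵇ t) ∧ ((1 ≤ᵇ a) ∧ (0 ≤ᵇ b))) * chainCount n a b ts)
  nonempty zero    zero    _ _ rewrite not-true⇒false {0 ≡ᵇ t} (λ e → <-irrefl (from-≡ᵇ e) 0<t) = refl
  nonempty zero    (suc b) _ _ = refl
  nonempty (suc a) b       _ _ = refl

flagF-J2×n : ∀ n → 0 < n → (T : Subset (2 * n ∸ 1)) →
  flagF (J2×n n) T ≡ sumOverSubsets (λ U → tableauCount n 0 0 (elems U)) T
flagF-J2×n n 0<n T = begin
  flagF (J2×n n) T                                 ≡⟨ flagF≡chainCount n T ⟩
  chainCount n 0 0 (elems T)                       ≡⟨ chainCount-from-empty n (elems T) from-zero ⟩
  chainCount n 1 0 (elems T)                       ≡⟨ chainCount≡subTableauCount n (elems T) 0 0 z≤n 0<n from-zero bounded ⟩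
  subTableauCount n 0 0 (elems T)                  ≡⟨ cong (subTableauCount n 0 0) (elems≡elemsFrom T) ⟩
  subTableauCount n 0 0 (elemsFrom 1 T)            ≡⟨ subTableauCount≡sumOverSubsets n 1 T 0 0 ⟩
  sumOverSubsets (λ U → tableauCount n 0 0 (elemsFrom 1 U)) T
    ≡⟨ sumL-cong (allVec _) (λ U → cong (λ l → ind (U ⊆ᵇ T) * tableauCount n 0 0 l) (sym (elems≡elemsFrom U))) ⟩
  sumOverSubsets (λ U → tableauCount n 0 0 (elems U)) T ∎
  where
  open ≡-Reasoning
  from-zero : Linked _<_ (0 ∷ elems T)
  from-zero = subst (λ l → Linked _<_ (0 ∷ l)) (sym (elems≡elemsFrom T)) (elemsFrom-increasing 0 1 z<s T)
  1+m≡n+n : 1 + (2 * n ∸ 1) ≡ n + n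
  1+m≡n+n = trans (m+[n∸m]≡n (≤-trans 0<n (m≤m+n n (n + 0)))) (cong (n +_) (+-identityʳ n))
  bounded : ∀ {z} → z ∈ elems T → z < n + n
  bounded {z} z∈ = subst (z <_) 1+m≡n+n (elemsFrom-bounded 1 T (subst (z ∈_) (elems≡elemsFrom T) z∈))

-- Imported only here: with +_ in scope, sections such as (a +_) above would be ambiguous.
open import Data.Integer using (+_)

theorem2p4 : (n : ℕ) → 0 < n → (k : ℕ) → (S : Subset (2 * n ∸ 1)) →
    ∣ S ∣ ≡ k → β n S ≡ + numTableaux n k S
theorem2p4 n 0<n k S ∣S∣≡k = begin
  β n S                             ≡⟨ flagH-möbius (J2×n n) (λ U → tableauCount n 0 0 (elems U)) (flagF-J2×n n 0<n) S ⟩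
  + tableauCount n 0 0 (elems S)    ≡⟨ cong +_ (numTableaux≡tableauCount n k S ∣S∣≡k) ⟨
  + numTableaux n k S               ∎
  where open ≡-Reasoning
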